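{- Let $n\ge 2$ and $k\ge1$ be integers, and for each $1\le i\le n$ let $S_i=(a_{i(1)},\ldots,a_{i(m_i)})$ be a non-empty ordered tuple of positive integers, where $m_1\ge 2$. Let $\bar{S_1}=(a_{1(2)},\ldots,a_{1(m_1)})$. Then \[ P_{T(1,S_1,\ldots,S_n,k)}(X)=\frac{P_{T(1,S_2,\ldots,S_n,k)}(X)\,P_{L(a_{1(1)},\ldots,a_{1(m_1)},k)}(X)}{(X)_k} - a_{1(1)}\frac{(X)_{a_{1(1)}+a_{1(2)}}\,P_{T(1,\bar{S_1},S_2,\ldots,S_n,k)}(X)}{(X)_{a_{1(2)}+1}}. \]
   Context: All graphs are finite and simple; $P_G(X)$ denotes the chromatic polynomial of $G$ (the monic polynomial counting proper $q$-colourings at $X=q\in\mathbb{N}$). For an integer $j\ge0$, $(X)_j=X(X-1)\cdots(X-j+1)$ is the falling factorial. The clique-path $L(b_1,\ldots,b_t)$ (for positive integers $b_i$) is obtained from a path on vertices $1,\ldots,t$ by replacing vertex $i$ with a clique of size $b_i$ and joining every vertex of the $i$th clique to every vertex of the $(i+1)$th clique, for $1\le i<t$. The clique-theta graph $T(1,S_1,\ldots,S_n,k)$, for non-empty tuples $S_i=(a_{i(1)},\ldots,a_{i(m_i)})$ of positive integers, is obtained by taking the $n$ clique-paths $L(1,a_{i(1)},\ldots,a_{i(m_i)},k)$, $1\le i\le n$, identifying their initial single-vertex cliques into one vertex, and identifying their final cliques of size $k$ into one clique of size $k$. -}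

module Defs where

open import Data.Nat using (ℕ; zero; suc; _+_; _*_; _∸_; _≡ᵇ_)
open import Data.Bool using (Bool; true; false; not; _∧_; _∨_)
open import Data.Product using (_×_; _,_)
open import Data.List using (List; []; _∷_; _++_; map; concatMap; concat; length; filter; upTo; zipWith)
open import Data.Bool.ListAction using (and; any)
open import Data.List.Base as L using ()
open import Data.Maybe using (Maybe; just; nothing)

-- Finite simple graphs given by an explicit list of (distinct) vertices
-- and a symmetric, irreflexive Boolean adjacency.

record Graph : Set₁ where
  field
    V     : Set
    verts : List V
    adj   : V → V → Bool
open Graph public

colourings : ℕ → ℕ → List (List ℕ)
colourings q zero    = [] ∷ []
colourings q (suc n) = concatMap (λ c → map (c ∷_) (colourings q n)) (upTo q)

-- a colouring (one colour per vertex, in the order of the vertex list) is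
-- proper iff no two adjacent vertices receive the same colour
properB : {V : Set} → (V → V → Bool) → List V → List ℕ → Bool
properB adj (v ∷ vs) (c ∷ cs) =
  and (zipWith (λ w d → not (adj v w ∧ (c ≡ᵇ d))) vs cs) ∧ properB adj vs cs
properB adj _ _ = true

chromPoly : Graph → ℕ → ℕ
chromPoly G q = length (filter (λ c → properB (adj G) (verts G) c ≡ᵇ' true)
                               (colourings q (length (verts G))))
  where
  open import Relation.Nullary using (Dec; yes; no)
  open import Relation.Binary.PropositionalEquality using (_≡_)
  open import Data.Bool using (_≟_)
  _≡ᵇ'_ : (x y : Bool) → Dec (x ≡ y)
  _≡ᵇ'_ = _≟_

ff : ℕ → ℕ → ℕ
ff q zero    = 1
ff q (suc j) = ff q j * (q ∸ j)

-- Blow-up of a "block graph": block b (b < length sizes) is replaced by a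
-- clique of size (sizes ! b); block edges in E become complete joins.
-- Vertices are pairs (block , position).

size : List ℕ → ℕ → ℕ
size [] b = 0
size (s ∷ ss) zero = s
size (s ∷ ss) (suc b) = size ss b

edgeIn : List (ℕ × ℕ) → ℕ → ℕ → Bool
edgeIn E b b' = any (λ { (x , y) → ((x ≡ᵇ b) ∧ (y ≡ᵇ b')) ∨ ((x ≡ᵇ b') ∧ (y ≡ᵇ b)) }) E

blowUp : List ℕ → List (ℕ × ℕ) → Graph
blowUp sizes E = record
  { V     = ℕ × ℕ
  ; verts = concatMap (λ b → map (λ p → (b , p)) (upTo (size sizes b))) (upTo (length sizes))
  ; adj   = λ { (b , p) (b' , p') →
              ((b ≡ᵇ b') ∧ not (p ≡ᵇ p')) ∨ edgeIn E b b' }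
  }

-- clique-path L(b_1,…,b_t): blocks 0,…,t-1 with edges (i , i+1)
cliquePath : List ℕ → Graph
cliquePath bs = blowUp bs (map (λ i → (i , suc i)) (upTo (length bs ∸ 1)))

-- clique-theta T(1,S_1,…,S_n,k): block 0 = the initial single vertex,
-- block 1 = the final clique of size k, the blocks of S_1, S_2, … follow
-- consecutively.  Each S_i (non-empty) forms a path
--   0 — (first block of S_i) — … — (last block of S_i) — 1.
pathEdges : ℕ → ℕ → List (ℕ × ℕ)
pathEdges o zero    = []
pathEdges o (suc m) = (0 , o) ∷ (o + m , 1) ∷ map (λ j → (o + j , o + suc j)) (upTo m)

thetaEdges : ℕ → List (List ℕ) → List (ℕ × ℕ)
thetaEdges o []       = []
thetaEdges o (S ∷ Ss) = pathEdges o (length S) ++ thetaEdges (o + length S) Ss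

cliqueTheta : List (List ℕ) → ℕ → Graph
cliqueTheta Ss k = blowUp (1 ∷ k ∷ concat Ss) (thetaEdges 2 Ss)

-- Colouring a clique of size s that must avoid a colour set F
--    is a sum over injective s-tuples of colours (tuples); colouring a clique-path
--    whose first and last blocks avoid colour sets U and V is pathCount U ss V.
-- 2. For fixed colours c₀ of the initial vertex and ks of the final k-clique the
--    arms of a clique-theta graph are coloured independently, whence
--      P_T(q) = Σ_{c₀} Σ_{ks} ∏ᵢ pathCount [c₀] Sᵢ ks          (chromPoly-theta),
--    and, by the reversal symmetry of pathCount,
--      P_{L(ss,k)}(q) = (q)_k · pathCount [] ss ks             (pathCount-close).
-- 3. The heart is the recurrence for a single arm (pathCount-recurrence), obtained
--    by conditioning on whether c₀ occurs on the second block, together with the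
--    falling-factorial identity ff-split.
-- 4. Multiplying the arm recurrence by the contributions of the other arms and
--    summing over c₀ and ks gives the identity in ℕ (identityℕ); lemma5 is its
--    rearrangement in ℤ.
module Submission where

open import Defs
open import Data.Nat using (ℕ; zero; suc; _+_; _*_; _∸_; _≤_; _<_; z≤n; s≤s; _≡ᵇ_; _≤?_)
open import Data.Nat.Properties
open import Data.Nat.Solver using (module +-*-Solver)
open import Data.Nat.ListAction using (product)
open import Algebra.Properties.CommutativeSemigroup +-commutativeSemigroup using () renaming (interchange to +-interchange)
open import Data.Bool using (Bool; true; false; not; _∧_; _∨_; if_then_else_)
import Data.Bool as B
open import Data.Bool.ListAction using (and)
open import Data.Bool.Properties using (∧-assoc; ∧-comm; ∨-comm; ∨-assoc; ∧-identityʳ; ∨-zeroʳ; ∨-identityʳ; ∧-zeroʳ)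
open import Data.Empty using (⊥-elim)
open import Data.List using (List; []; _∷_; _++_; length; map; concat; concatMap; applyUpTo; upTo; filter; zipWith; reverse)
open import Data.List.Membership.Propositional using (_∈_)
open import Data.List.Membership.Propositional.Properties using (∈-map⁻; ∈-map⁺; ∈-++⁻; ∈-++⁺ˡ; ∈-++⁺ʳ; ∈-upTo⁻; ∈-upTo⁺)
open import Data.List.Properties using (++-assoc; length-++; ++-identityʳ; concatMap-++; unfold-reverse; reverse-++; length-reverse)
open import Data.List.Relation.Unary.All using (All; []; _∷_)
open import Data.List.Relation.Unary.Any using (here; there)
open import Data.Product using (_×_; _,_; Σ; proj₁; proj₂)
open import Data.Product.Properties using (,-injective)
open import Data.Sum using (_⊎_; inj₁; inj₂)
open import Data.Unit using (⊤; tt)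
open import Relation.Binary.PropositionalEquality
open import Relation.Nullary using (¬_; yes; no)

sumTo : ℕ → (ℕ → ℕ) → ℕ
sumTo zero f = 0
sumTo (suc n) f = f 0 + sumTo n (λ i → f (suc i))

when : Bool → ℕ → ℕ
when true x = x
when false x = 0

sumTo-cong : ∀ n {f g : ℕ → ℕ} → (∀ i → i < n → f i ≡ g i) → sumTo n f ≡ sumTo n g
sumTo-cong zero h = refl
sumTo-cong (suc n) h = cong₂ _+_ (h 0 (s≤s z≤n)) (sumTo-cong n (λ i i<n → h (suc i) (s≤s i<n)))

sumTo-0 : ∀ n → sumTo n (λ _ → 0) ≡ 0
sumTo-0 zero = refl
sumTo-0 (suc n) = sumTo-0 n

sumTo-+ : ∀ n (f g : ℕ → ℕ) → sumTo n (λ i → f i + g i) ≡ sumTo n f + sumTo n g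
sumTo-+ zero f g = refl
sumTo-+ (suc n) f g =
  trans (cong (f 0 + g 0 +_) (sumTo-+ n (λ i → f (suc i)) (λ i → g (suc i))))
        (+-interchange (f 0) (g 0) _ _)

sumTo-*ʳ : ∀ n (f : ℕ → ℕ) m → sumTo n (λ i → f i * m) ≡ sumTo n f * m
sumTo-*ʳ zero f m = refl
sumTo-*ʳ (suc n) f m = trans (cong (f 0 * m +_) (sumTo-*ʳ n (λ i → f (suc i)) m)) (sym (*-distribʳ-+ m (f 0) _))

sumTo-swap : ∀ n m (f : ℕ → ℕ → ℕ) → sumTo n (λ i → sumTo m (λ j → f i j)) ≡ sumTo m (λ j → sumTo n (λ i → f i j))
sumTo-swap zero m f = sym (sumTo-0 m)
sumTo-swap (suc n) m f =
  trans (cong (sumTo m (λ j → f 0 j) +_) (sumTo-swap n m (λ i j → f (suc i) j)))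
        (sym (sumTo-+ m (λ j → f 0 j) (λ j → sumTo n (λ i → f (suc i) j))))

sumTo-last : ∀ n (f : ℕ → ℕ) → sumTo (suc n) f ≡ sumTo n f + f n
sumTo-last zero f = +-comm (f 0) 0
sumTo-last (suc n) f = trans (cong (f 0 +_) (sumTo-last n (λ i → f (suc i)))) (sym (+-assoc (f 0) _ _))

when-+ : ∀ b x y → when b (x + y) ≡ when b x + when b y
when-+ true x y = refl
when-+ false x y = refl

when-*ʳ : ∀ b x m → when b (x * m) ≡ when b x * m
when-*ʳ true x m = refl
when-*ʳ false x m = refl

when-Σ : ∀ b n (f : ℕ → ℕ) → when b (sumTo n f) ≡ sumTo n (λ i → when b (f i))
when-Σ true n f = refl
when-Σ false n f = sym (sumTo-0 n)

when-0 : ∀ b → when b 0 ≡ 0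
when-0 true = refl
when-0 false = refl

elem : ℕ → List ℕ → Bool
elem c [] = false
elem c (x ∷ L) = (x ≡ᵇ c) ∨ elem c L

≡ᵇ-refl : ∀ n → (n ≡ᵇ n) ≡ true
≡ᵇ-refl zero = refl
≡ᵇ-refl (suc n) = ≡ᵇ-refl n

≡ᵇ-true⇒≡ : ∀ m n → (m ≡ᵇ n) ≡ true → m ≡ n
≡ᵇ-true⇒≡ zero zero e = refl
≡ᵇ-true⇒≡ (suc m) (suc n) e = cong suc (≡ᵇ-true⇒≡ m n e)

≢⇒≡ᵇ-false : ∀ m n → m ≢ n → (m ≡ᵇ n) ≡ false
≢⇒≡ᵇ-false m n ne with m ≡ᵇ n in eq
... | false = refl
... | true = ⊥-elim (ne (≡ᵇ-true⇒≡ m n eq))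

≡ᵇ-false⇒≢ : ∀ m n → (m ≡ᵇ n) ≡ false → m ≢ n
≡ᵇ-false⇒≢ m .m e refl with trans (sym e) (≡ᵇ-refl m)
... | ()

≡ᵇ-sym : ∀ m n → (m ≡ᵇ n) ≡ (n ≡ᵇ m)
≡ᵇ-sym zero zero = refl
≡ᵇ-sym zero (suc n) = refl
≡ᵇ-sym (suc m) zero = refl
≡ᵇ-sym (suc m) (suc n) = ≡ᵇ-sym m n

elem-++ : ∀ c A B → elem c (A ++ B) ≡ elem c A ∨ elem c B
elem-++ c [] B = refl
elem-++ c (x ∷ A) B = trans (cong ((x ≡ᵇ c) ∨_) (elem-++ c A B)) (sym (∨-assoc (x ≡ᵇ c) _ _))

elem-++-comm : ∀ A B x → elem x (A ++ B) ≡ elem x (B ++ A)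
elem-++-comm A B x = trans (elem-++ x A B) (trans (∨-comm (elem x A) _) (sym (elem-++ x B A)))

not-∨ : ∀ a b → not (a ∨ b) ≡ not a ∧ not b
not-∨ true b = refl
not-∨ false b = refl

Distinct : List ℕ → Set
Distinct [] = ⊤
Distinct (x ∷ L) = (elem x L ≡ false) × Distinct L

rem : ℕ → List ℕ → List ℕ
rem n [] = []
rem n (x ∷ L) = if x ≡ᵇ n then rem n L else x ∷ rem n L

elem-rem : ∀ d n L → d ≢ n → elem d (rem n L) ≡ elem d L
elem-rem d n [] ne = refl
elem-rem d n (x ∷ L) ne with x ≡ᵇ n in e
... | true rewrite ≡ᵇ-true⇒≡ x n e | ≢⇒≡ᵇ-false n d (λ eq → ne (sym eq)) = elem-rem d n L ne
... | false = cong ((x ≡ᵇ d) ∨_) (elem-rem d n L ne)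

length-rem-absent : ∀ n L → elem n L ≡ false → length (rem n L) ≡ length L
length-rem-absent n [] h = refl
length-rem-absent n (x ∷ L) h with x ≡ᵇ n in e
length-rem-absent n (x ∷ L) () | true
... | false = cong suc (length-rem-absent n L h)

length-rem-present : ∀ n L → elem n L ≡ true → Distinct L → length L ≡ suc (length (rem n L))
length-rem-present n (x ∷ L) h (dx , dL) with x ≡ᵇ n in e
... | true rewrite ≡ᵇ-true⇒≡ x n e = cong suc (sym (length-rem-absent n L dx))
... | false = cong suc (length-rem-present n L h dL)

distinct-rem : ∀ n L → Distinct L → Distinct (rem n L)
distinct-rem n [] d = tt
distinct-rem n (x ∷ L) (dx , dL) with x ≡ᵇ n in e
... | true = distinct-rem n L dL
... | false = trans (elem-rem x n L (≡ᵇ-false⇒≢ x n e)) dx , distinct-rem n L dL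

bounded-rem : ∀ n L → All (_< suc n) L → All (_< n) (rem n L)
bounded-rem n [] a = []
bounded-rem n (x ∷ L) (px ∷ a) with x ≡ᵇ n in e
... | true = bounded-rem n L a
... | false = ≤∧≢⇒< (≤-pred px) (≡ᵇ-false⇒≢ x n e) ∷ bounded-rem n L a

bounded-absent : ∀ n L → All (_< suc n) L → elem n L ≡ false → All (_< n) L
bounded-absent n [] a h = []
bounded-absent n (x ∷ L) (px ∷ a) h with x ≡ᵇ n in e
bounded-absent n (x ∷ L) (px ∷ a) () | true
... | false = ≤∧≢⇒< (≤-pred px) (≡ᵇ-false⇒≢ x n e) ∷ bounded-absent n L a h

-- Among the q colours, exactly q - |L| avoid a list L of distinct colours < q.
-- Proof by induction on q, removing the top colour q-1 from L if it occurs.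
count-unused : ∀ q L → Distinct L → All (_< q) L → sumTo q (λ d → when (not (elem d L)) 1) + length L ≡ q
count-unused zero [] d a = refl
count-unused zero (x ∷ L) d (() ∷ a)
count-unused (suc n) L d a with elem n L in e
... | true = begin
     sumTo (suc n) f + length L
       ≡⟨ cong₂ _+_ (sumTo-last n f) (length-rem-present n L e d) ⟩
     sumTo n f + when (not (elem n L)) 1 + suc (length (rem n L))
       ≡⟨ cong (λ z → sumTo n f + when (not z) 1 + suc (length (rem n L))) e ⟩
     sumTo n f + 0 + suc (length (rem n L))
       ≡⟨ cong (λ z → z + suc (length (rem n L))) (+-identityʳ (sumTo n f)) ⟩
     sumTo n f + suc (length (rem n L))
       ≡⟨ +-suc (sumTo n f) _ ⟩
     suc (sumTo n f + length (rem n L))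
       ≡⟨ cong (λ z → suc (z + length (rem n L))) (sumTo-cong n (λ i i<n → cong (λ z → when (not z) 1) (sym (elem-rem i n L (<⇒≢ i<n))))) ⟩
     suc (sumTo n (λ i → when (not (elem i (rem n L))) 1) + length (rem n L))
       ≡⟨ cong suc (count-unused n (rem n L) (distinct-rem n L d) (bounded-rem n L a)) ⟩
     suc n ∎
  where open ≡-Reasoning
        f = λ d → when (not (elem d L)) 1
... | false = begin
     sumTo (suc n) f + length L
       ≡⟨ cong (_+ length L) (sumTo-last n f) ⟩
     sumTo n f + when (not (elem n L)) 1 + length L
       ≡⟨ cong (λ z → sumTo n f + when (not z) 1 + length L) e ⟩
     sumTo n f + 1 + length L
       ≡⟨ cong (_+ length L) (+-comm (sumTo n f) 1) ⟩
     suc (sumTo n f + length L)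
       ≡⟨ cong suc (count-unused n L d (bounded-absent n L a e)) ⟩
     suc n ∎
  where open ≡-Reasoning
        f = λ d → when (not (elem d L)) 1

ff-suc-front : ∀ x s → ff x (suc s) ≡ x * ff (x ∸ 1) s
ff-suc-front x zero = trans (*-identityˡ (x ∸ 0)) (sym (*-identityʳ x))
ff-suc-front x (suc s) = begin
  ff x (suc s) * (x ∸ suc s)      ≡⟨ cong₂ _*_ (ff-suc-front x s) (sym (∸-+-assoc x 1 s)) ⟩
  x * ff (x ∸ 1) s * (x ∸ 1 ∸ s)  ≡⟨ *-assoc x _ _ ⟩
  x * ff (x ∸ 1) (suc s) ∎
  where open ≡-Reasoning

ff-add : ∀ q b a → ff q (b + a) ≡ ff q b * ff (q ∸ b) a
ff-add q b zero rewrite +-identityʳ b = sym (*-identityʳ (ff q b))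
ff-add q b (suc a) rewrite +-suc b a = begin
  ff q (b + a) * (q ∸ (b + a))          ≡⟨ cong₂ _*_ (ff-add q b a) (sym (∸-+-assoc q b a)) ⟩
  ff q b * ff (q ∸ b) a * (q ∸ b ∸ a)  ≡⟨ *-assoc (ff q b) _ _ ⟩
  ff q b * ff (q ∸ b) (suc a) ∎
  where open ≡-Reasoning

ff-zero : ∀ x a → x < a → ff x a ≡ 0
ff-zero x (suc a) (s≤s x≤a) with m≤n⇒m<n∨m≡n x≤a
... | inj₁ x<a rewrite ff-zero x a x<a = refl
... | inj₂ refl rewrite n∸n≡0 x = *-zeroʳ (ff x x)

-- (x)_a · x = (x-1)_a · x + a (x)_a, i.e. x (x-1)_a = (x)_a (x-a) + a (x)_a
-- read in ℕ (both sides vanish when a > x).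
ff-shift : ∀ x a → ff x a * x ≡ ff (x ∸ 1) a * x + a * ff x a
ff-shift x a with a ≤? x
... | yes a≤x = begin
  ff x a * x                      ≡⟨ cong (ff x a *_) (sym (m∸n+n≡m a≤x)) ⟩
  ff x a * ((x ∸ a) + a)          ≡⟨ *-distribˡ-+ (ff x a) (x ∸ a) a ⟩
  ff x a * (x ∸ a) + ff x a * a   ≡⟨ cong₂ _+_ (ff-suc-front x a) (*-comm (ff x a) a) ⟩
  x * ff (x ∸ 1) a + a * ff x a   ≡⟨ cong (_+ a * ff x a) (*-comm x _) ⟩
  ff (x ∸ 1) a * x + a * ff x a ∎
  where open ≡-Reasoning
... | no a≰x = begin
  ff x a * x                      ≡⟨ cong (_* x) vanish ⟩
  0                               ≡⟨ sym (cong₂ _+_ shifted-vanish (trans (cong (a *_) vanish) (*-zeroʳ a))) ⟩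
  ff (x ∸ 1) a * x + a * ff x a ∎
  where
  open ≡-Reasoning
  vanish : ff x a ≡ 0
  vanish = ff-zero x a (≰⇒> a≰x)
  shifted-vanish : ff (x ∸ 1) a * x ≡ 0
  shifted-vanish = trans (*-comm _ x) (trans (sym (ff-suc-front x a)) (cong (_* (x ∸ a)) vanish))

-- The falling-factorial identity behind the arm recurrence:
--   (q-b)_a (q)_{b+1} = (q-b-1)_a (q)_{b+1} + a (q)_{a+b}.
-- It is ff-shift at x = q - b, multiplied by (q)_b.
ff-split : ∀ q a b → ff (q ∸ b) a * ff q (suc b) ≡ ff (q ∸ suc b) a * ff q (suc b) + a * ff q (a + b)
ff-split q a b = begin
  ff x a * (F * x)
    ≡⟨ scale (ff x a) F x (ff (x ∸ 1) a) (a * ff x a) (ff-shift x a) ⟩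
  ff (x ∸ 1) a * (F * x) + F * (a * ff x a)
    ≡⟨ cong₂ (λ z w → ff z a * (F * x) + w) x-1≡q-[b+1] (trans (swap F a (ff x a)) (cong (a *_) (sym ff-a+b))) ⟩
  ff (q ∸ suc b) a * (F * x) + a * ff q (a + b) ∎
  where
  open ≡-Reasoning
  open +-*-Solver
  x = q ∸ b
  F = ff q b
  x-1≡q-[b+1] : x ∸ 1 ≡ q ∸ suc b
  x-1≡q-[b+1] = trans (∸-+-assoc q b 1) (cong (q ∸_) (+-comm b 1))
  ff-a+b : ff q (a + b) ≡ F * ff x a
  ff-a+b = trans (cong (ff q) (+-comm a b)) (ff-add q b a)
  swap : ∀ m n o → m * (n * o) ≡ n * (m * o)
  swap = solve 3 (λ m n o → m :* (n :* o) := n :* (m :* o)) refl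
  scale : ∀ A F x B C → A * x ≡ B * x + C → A * (F * x) ≡ B * (F * x) + F * C
  scale A F x B C h = begin
    A * (F * x)     ≡⟨ swap A F x ⟩
    F * (A * x)     ≡⟨ cong (F *_) h ⟩
    F * (B * x + C) ≡⟨ solve 4 (λ F B x C → F :* (B :* x :+ C) := B :* (F :* x) :+ F :* C) refl F B x C ⟩
    B * (F * x) + F * C ∎

countTrue : (List ℕ → Bool) → List (List ℕ) → ℕ
countTrue f [] = 0
countTrue f (x ∷ xs) = when (f x) 1 + countTrue f xs

countTrue-filter : ∀ (f : List ℕ → Bool) xs → length (filter (λ c → f c B.≟ true) xs) ≡ countTrue f xs
countTrue-filter f [] = refl
countTrue-filter f (x ∷ xs) with f x
... | true = cong suc (countTrue-filter f xs)
... | false = countTrue-filter f xs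

countTrue-++ : ∀ f xs ys → countTrue f (xs ++ ys) ≡ countTrue f xs + countTrue f ys
countTrue-++ f [] ys = refl
countTrue-++ f (x ∷ xs) ys = trans (cong (when (f x) 1 +_) (countTrue-++ f xs ys)) (sym (+-assoc (when (f x) 1) _ _))

countTrue-map : ∀ f c xs → countTrue f (map (c ∷_) xs) ≡ countTrue (λ cs → f (c ∷ cs)) xs
countTrue-map f c [] = refl
countTrue-map f c (x ∷ xs) = cong (when (f (c ∷ x)) 1 +_) (countTrue-map f c xs)

countTrue-cong : ∀ {f g} xs → (∀ x → f x ≡ g x) → countTrue f xs ≡ countTrue g xs
countTrue-cong [] h = refl
countTrue-cong (x ∷ xs) h = cong₂ _+_ (cong (λ b → when b 1) (h x)) (countTrue-cong xs h)

countTrue-∧ : ∀ b g xs → countTrue (λ x → b ∧ g x) xs ≡ when b (countTrue g xs)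
countTrue-∧ true g xs = refl
countTrue-∧ false g [] = refl
countTrue-∧ false g (x ∷ xs) = countTrue-∧ false g xs

countTrue-concatMap : ∀ f (g : ℕ → List (List ℕ)) n (h : ℕ → ℕ) →
  countTrue f (concatMap g (applyUpTo h n)) ≡ sumTo n (λ i → countTrue f (g (h i)))
countTrue-concatMap f g zero h = refl
countTrue-concatMap f g (suc n) h = trans (countTrue-++ f (g (h 0)) _) (cong (countTrue f (g (h 0)) +_) (countTrue-concatMap f g n (λ i → h (suc i))))

∧-interchange : ∀ a b x y → (a ∧ b) ∧ (x ∧ y) ≡ (a ∧ x) ∧ (b ∧ y)
∧-interchange true true x y = refl
∧-interchange true false x y = sym (∧-comm x false)
∧-interchange false b x y = refl

∧-shuffle : ∀ a b o c → (a ∧ b) ∧ (o ∧ c) ≡ o ∧ (b ∧ (a ∧ c))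
∧-shuffle true true o c = refl
∧-shuffle true false o c = sym (∧-zeroʳ o)
∧-shuffle false b o c = sym (trans (cong (o ∧_) (∧-zeroʳ b)) (∧-zeroʳ o))

-- A context is a list of already coloured vertices.  `ok ctx v c` says colour c
-- at v clashes with no coloured neighbour; `cntK ctx vs κ` sums κ over all ways
-- of extending the context by colours of vs, one vertex at a time.
module Cnt (q : ℕ) {V : Set} (adj : V → V → Bool) where

  ok : List (V × ℕ) → V → ℕ → Bool
  ok [] v c = true
  ok ((u , d) ∷ ctx) v c = not (adj u v ∧ (d ≡ᵇ c)) ∧ ok ctx v c

  cntK : List (V × ℕ) → List V → (List (V × ℕ) → ℕ) → ℕ
  cntK ctx [] κ = κ ctx
  cntK ctx (v ∷ vs) κ = sumTo q (λ c → when (ok ctx v c) (cntK ((v , c) ∷ ctx) vs κ))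

  cnt : List (V × ℕ) → List V → ℕ
  cnt ctx vs = cntK ctx vs (λ _ → 1)

  compat : List (V × ℕ) → List V → List ℕ → Bool
  compat ctx (v ∷ vs) (c ∷ cs) = ok ctx v c ∧ compat ctx vs cs
  compat ctx _ _ = true

  compat-cons : ∀ ctx v c vs cs → compat ((v , c) ∷ ctx) vs cs ≡
     and (zipWith (λ w d → not (adj v w ∧ (c ≡ᵇ d))) vs cs) ∧ compat ctx vs cs
  compat-cons ctx v c [] cs = refl
  compat-cons ctx v c (w ∷ vs) [] = refl
  compat-cons ctx v c (w ∷ vs) (d ∷ cs) rewrite compat-cons ctx v c vs cs =
    ∧-interchange (not (adj v w ∧ (c ≡ᵇ d))) (ok ctx w d) (and (zipWith (λ w d → not (adj v w ∧ (c ≡ᵇ d))) vs cs)) (compat ctx vs cs)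

  compat-[] : ∀ vs cs → compat [] vs cs ≡ true
  compat-[] [] cs = refl
  compat-[] (v ∷ vs) [] = refl
  compat-[] (v ∷ vs) (c ∷ cs) = compat-[] vs cs

  proper-first : ∀ ctx v vs c cs →
    properB adj (v ∷ vs) (c ∷ cs) ∧ compat ctx (v ∷ vs) (c ∷ cs)
    ≡ ok ctx v c ∧ (properB adj vs cs ∧ compat ((v , c) ∷ ctx) vs cs)
  proper-first ctx v vs c cs rewrite compat-cons ctx v c vs cs =
    ∧-shuffle (and (zipWith (λ w d → not (adj v w ∧ (c ≡ᵇ d))) vs cs)) (properB adj vs cs) (ok ctx v c) (compat ctx vs cs)

  countTrue-proper≡cnt : ∀ ctx vs → countTrue (λ cs → properB adj vs cs ∧ compat ctx vs cs) (colourings q (length vs)) ≡ cnt ctx vs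
  countTrue-proper≡cnt ctx [] = refl
  countTrue-proper≡cnt ctx (v ∷ vs) = begin
    countTrue P (concatMap (λ c → map (c ∷_) Cs) (upTo q))
      ≡⟨ countTrue-concatMap P (λ c → map (c ∷_) Cs) q (λ i → i) ⟩
    sumTo q (λ c → countTrue P (map (c ∷_) Cs))
      ≡⟨ sumTo-cong q (λ c _ → first-colour c) ⟩
    cnt ctx (v ∷ vs) ∎
    where
    open ≡-Reasoning
    Cs = colourings q (length vs)
    P = λ cs → properB adj (v ∷ vs) cs ∧ compat ctx (v ∷ vs) cs
    first-colour : ∀ c → countTrue P (map (c ∷_) Cs) ≡ when (ok ctx v c) (cnt ((v , c) ∷ ctx) vs)
    first-colour c = begin
      countTrue P (map (c ∷_) Cs)
        ≡⟨ countTrue-map P c Cs ⟩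
      countTrue (λ cs → P (c ∷ cs)) Cs
        ≡⟨ countTrue-cong Cs (proper-first ctx v vs c) ⟩
      countTrue (λ cs → ok ctx v c ∧ (properB adj vs cs ∧ compat ((v , c) ∷ ctx) vs cs)) Cs
        ≡⟨ countTrue-∧ (ok ctx v c) _ Cs ⟩
      when (ok ctx v c) (countTrue (λ cs → properB adj vs cs ∧ compat ((v , c) ∷ ctx) vs cs) Cs)
        ≡⟨ cong (when (ok ctx v c)) (countTrue-proper≡cnt ((v , c) ∷ ctx) vs) ⟩
      when (ok ctx v c) (cnt ((v , c) ∷ ctx) vs) ∎

chromPoly≡cnt : ∀ G q → chromPoly G q ≡ Cnt.cnt q (adj G) [] (verts G)
chromPoly≡cnt G q = begin
  chromPoly G q
    ≡⟨ countTrue-filter proper Cs ⟩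
  countTrue proper Cs
    ≡⟨ countTrue-cong Cs (λ cs → sym (trans (cong (proper cs ∧_) (Cnt.compat-[] q (adj G) (verts G) cs)) (∧-identityʳ (proper cs)))) ⟩
  countTrue (λ cs → proper cs ∧ Cnt.compat q (adj G) [] (verts G) cs) Cs
    ≡⟨ Cnt.countTrue-proper≡cnt q (adj G) [] (verts G) ⟩
  Cnt.cnt q (adj G) [] (verts G) ∎
  where
  open ≡-Reasoning
  proper = properB (adj G) (verts G)
  Cs = colourings q (length (verts G))

module CntProperties (q : ℕ) {V : Set} (adj : V → V → Bool) where
  open Cnt q adj

  cntK-++ : ∀ ctx xs ys κ → cntK ctx (xs ++ ys) κ ≡ cntK ctx xs (λ Γ → cntK Γ ys κ)
  cntK-++ ctx [] ys κ = refl
  cntK-++ ctx (x ∷ xs) ys κ = sumTo-cong q (λ c _ → cong (when (ok ctx x c)) (cntK-++ ((x , c) ∷ ctx) xs ys κ))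

  ext : List (V × ℕ) → List V → List ℕ → List (V × ℕ)
  ext ctx (x ∷ xs) (c ∷ cs) = ext ((x , c) ∷ ctx) xs cs
  ext ctx _ _ = ctx

  cntK-ext : ∀ ctx xs {κ₁ κ₂} → (∀ cs → κ₁ (ext ctx xs cs) ≡ κ₂ (ext ctx xs cs)) → cntK ctx xs κ₁ ≡ cntK ctx xs κ₂
  cntK-ext ctx [] h = h []
  cntK-ext ctx (x ∷ xs) h = sumTo-cong q (λ c _ → cong (when (ok ctx x c)) (cntK-ext ((x , c) ∷ ctx) xs (λ cs → h (c ∷ cs))))

  cntK-const : ∀ ctx xs m → cntK ctx xs (λ _ → m) ≡ cnt ctx xs * m
  cntK-const ctx [] m = sym (+-identityʳ m)
  cntK-const ctx (x ∷ xs) m = trans (sumTo-cong q (λ c _ → trans (cong (when (ok ctx x c)) (cntK-const ((x , c) ∷ ctx) xs m)) (when-*ʳ (ok ctx x c) _ m)))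
     (sumTo-*ʳ q _ m)

  cnt-context-cong : ∀ Δ Δ' R → (∀ v → v ∈ R → ∀ c → ok Δ v c ≡ ok Δ' v c) → cnt Δ R ≡ cnt Δ' R
  cnt-context-cong Δ Δ' [] h = refl
  cnt-context-cong Δ Δ' (v ∷ R) h = sumTo-cong q (λ c _ → cong₂ when (h v (here refl) c)
     (cnt-context-cong ((v , c) ∷ Δ) ((v , c) ∷ Δ') R (λ w w∈ d → cong (not (adj v w ∧ (c ≡ᵇ d)) ∧_) (h w (there w∈) d))))

  ok-ext : ∀ ctx xs cs v c → (∀ x → x ∈ xs → adj x v ≡ false) → ok (ext ctx xs cs) v c ≡ ok ctx v c
  ok-ext ctx [] cs v c h = refl
  ok-ext ctx (x ∷ xs) [] v c h = refl
  ok-ext ctx (x ∷ xs) (d ∷ cs) v c h rewrite ok-ext ((x , d) ∷ ctx) xs cs v c (λ y y∈ → h y (there y∈)) | h x (here refl) = refl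

  cnt-independent : ∀ ctx xs ys → (∀ u → u ∈ xs → ∀ v → v ∈ ys → adj u v ≡ false) → cnt ctx (xs ++ ys) ≡ cnt ctx xs * cnt ctx ys
  cnt-independent ctx xs ys h = begin
    cntK ctx (xs ++ ys) (λ _ → 1)        ≡⟨ cntK-++ ctx xs ys _ ⟩
    cntK ctx xs (λ Γ → cnt Γ ys)          ≡⟨ cntK-ext ctx xs (λ cs → cnt-context-cong _ ctx ys (λ v v∈ c → ok-ext ctx xs cs v c (λ u u∈ → h u u∈ v v∈))) ⟩
    cntK ctx xs (λ _ → cnt ctx ys)        ≡⟨ cntK-const ctx xs _ ⟩
    cnt ctx xs * cnt ctx ys ∎
    where open ≡-Reasoning

  ok-++ : ∀ xs ys v c → ok (xs ++ ys) v c ≡ ok xs v c ∧ ok ys v c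
  ok-++ [] ys v c = refl
  ok-++ ((u , d) ∷ xs) ys v c rewrite ok-++ xs ys v c = sym (∧-assoc (not (adj u v ∧ (d ≡ᵇ c))) _ _)

-- Injective colour tuples.  tuples F s W κ sums κ over all lists obtained by
-- prepending s new colours to W, where the new colours are < q, pairwise distinct, distinct from
-- W and outside the forbidden set F.  With W = [] it counts the colourings of an
-- s-clique all of whose vertices must avoid F (weighted by κ).
module Tuples (q : ℕ) where

  tuples : List ℕ → ℕ → List ℕ → (List ℕ → ℕ) → ℕ
  tuples F zero W κ = κ W
  tuples F (suc s) W κ = sumTo q (λ c → when (not (elem c W) ∧ not (elem c F)) (tuples F s (c ∷ W) κ))

  data Grows (F : List ℕ) : ℕ → List ℕ → List ℕ → Set where
    grow0 : ∀ {W} → Grows F 0 W W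
    growS : ∀ {s W u} c → c < q → elem c W ≡ false → elem c F ≡ false → Grows F s (c ∷ W) u → Grows F (suc s) W u

  tuples-ext : ∀ F s W {κ₁ κ₂} → (∀ u → Grows F s W u → κ₁ u ≡ κ₂ u) → tuples F s W κ₁ ≡ tuples F s W κ₂
  tuples-ext F zero W h = h W grow0
  tuples-ext F (suc s) W {κ₁} {κ₂} h = sumTo-cong q by-first-colour
    where
    by-first-colour : ∀ c → c < q → when (not (elem c W) ∧ not (elem c F)) (tuples F s (c ∷ W) κ₁) ≡ when (not (elem c W) ∧ not (elem c F)) (tuples F s (c ∷ W) κ₂)
    by-first-colour c c<q with elem c W in e₁ | elem c F in e₂
    ... | true | _ = refl
    ... | false | true = refl
    ... | false | false = tuples-ext F s (c ∷ W) (λ u g → h u (growS c c<q e₁ e₂ g))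

  tuples-cong : ∀ F s W {κ₁ κ₂} → (∀ u → κ₁ u ≡ κ₂ u) → tuples F s W κ₁ ≡ tuples F s W κ₂
  tuples-cong F s W h = tuples-ext F s W (λ u _ → h u)

  tuples-0 : ∀ F s W → tuples F s W (λ _ → 0) ≡ 0
  tuples-0 F zero W = refl
  tuples-0 F (suc s) W = trans (sumTo-cong q (λ c _ → trans (cong (when _) (tuples-0 F s (c ∷ W))) (when-0 _))) (sumTo-0 q)

  tuples-Σ : ∀ F s W n (g : ℕ → List ℕ → ℕ) → tuples F s W (λ u → sumTo n (λ c → g c u)) ≡ sumTo n (λ c → tuples F s W (g c))
  tuples-Σ F zero W n g = refl
  tuples-Σ F (suc s) W n g = begin
    sumTo q (λ d → when (b d) (tuples F s (d ∷ W) (λ u → sumTo n (λ c → g c u))))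
      ≡⟨ sumTo-cong q (λ d _ → trans (cong (when (b d)) (tuples-Σ F s (d ∷ W) n g)) (when-Σ (b d) n _)) ⟩
    sumTo q (λ d → sumTo n (λ c → when (b d) (tuples F s (d ∷ W) (g c))))
      ≡⟨ sumTo-swap q n (λ d c → when (b d) (tuples F s (d ∷ W) (g c))) ⟩
    sumTo n (λ c → tuples F (suc s) W (g c)) ∎
    where open ≡-Reasoning
          b = λ d → not (elem d W) ∧ not (elem d F)

  tuples-+ : ∀ F s W (κ₁ κ₂ : List ℕ → ℕ) → tuples F s W (λ u → κ₁ u + κ₂ u) ≡ tuples F s W κ₁ + tuples F s W κ₂
  tuples-+ F zero W κ₁ κ₂ = refl
  tuples-+ F (suc s) W κ₁ κ₂ = trans (sumTo-cong q (λ d _ → trans (cong (when _) (tuples-+ F s (d ∷ W) κ₁ κ₂)) (when-+ (not (elem d W) ∧ not (elem d F)) _ _)))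
     (sumTo-+ q _ _)

  tuples-*ʳ : ∀ F s W (κ : List ℕ → ℕ) m → tuples F s W (λ u → κ u * m) ≡ tuples F s W κ * m
  tuples-*ʳ F zero W κ m = refl
  tuples-*ʳ F (suc s) W κ m = trans (sumTo-cong q (λ d _ → trans (cong (when _) (tuples-*ʳ F s (d ∷ W) κ m)) (when-*ʳ (not (elem d W) ∧ not (elem d F)) _ m)))
     (sumTo-*ʳ q _ m)

  when-tuples : ∀ b F s W (κ : List ℕ → ℕ) → when b (tuples F s W κ) ≡ tuples F s W (λ u → when b (κ u))
  when-tuples true F s W κ = refl
  when-tuples false F s W κ = sym (tuples-0 F s W)

  tuples-forbid-cong : ∀ F F' s W κ → (∀ x → elem x F ≡ elem x F') → tuples F s W κ ≡ tuples F' s W κ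
  tuples-forbid-cong F F' zero W κ h = refl
  tuples-forbid-cong F F' (suc s) W κ h = sumTo-cong q (λ d _ → cong₂ (λ z w → when (not (elem d W) ∧ not z) w) (h d) (tuples-forbid-cong F F' s (d ∷ W) κ h))

  tuples-fubini : ∀ F s W E r V (h : List ℕ → List ℕ → ℕ) →
     tuples F s W (λ t → tuples E r V (λ x → h t x)) ≡ tuples E r V (λ x → tuples F s W (λ t → h t x))
  tuples-fubini F zero W E r V h = refl
  tuples-fubini F (suc s) W E r V h = begin
    sumTo q (λ c → when (b c) (tuples F s (c ∷ W) (λ t → tuples E r V (λ x → h t x))))
      ≡⟨ sumTo-cong q (λ c _ → trans (cong (when (b c)) (tuples-fubini F s (c ∷ W) E r V h)) (when-tuples (b c) E r V _)) ⟩
    sumTo q (λ c → tuples E r V (λ x → when (b c) (tuples F s (c ∷ W) (λ t → h t x))))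
      ≡⟨ sym (tuples-Σ E r V q (λ c x → when (b c) (tuples F s (c ∷ W) (λ t → h t x)))) ⟩
    tuples E r V (λ x → tuples F (suc s) W (λ t → h t x)) ∎
    where open ≡-Reasoning
          b = λ d → not (elem d W) ∧ not (elem d F)

  grows-⊇ : ∀ {F s W u} x → Grows F s W u → elem x W ≡ true → elem x u ≡ true
  grows-⊇ x grow0 h = h
  grows-⊇ x (growS c _ _ _ g) h = grows-⊇ x g (trans (cong ((c ≡ᵇ x) ∨_) h) (∨-zeroʳ (c ≡ᵇ x)))

  grows-length : ∀ {F s W u} → Grows F s W u → length u ≡ s + length W
  grows-length grow0 = refl
  grows-length {s = suc s} {W = W} (growS c _ _ _ g) = trans (grows-length g) (+-suc s (length W))

  grows-bounded : ∀ {F s W u} → Grows F s W u → All (_< q) W → All (_< q) u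
  grows-bounded grow0 a = a
  grows-bounded (growS c c<q _ _ g) a = grows-bounded g (c<q ∷ a)

  grows-distinct : ∀ {F s W u} → Grows F s W u → Distinct W → Distinct u
  grows-distinct grow0 d = d
  grows-distinct (growS c _ e _ g) d = grows-distinct g (e , d)

  tuples-vanish : ∀ F s W κ c → elem c W ≡ true → (∀ u → elem c u ≡ true → κ u ≡ 0) → tuples F s W κ ≡ 0
  tuples-vanish F s W κ c h z = trans (tuples-ext F s W (λ u g → z u (grows-⊇ c g h))) (tuples-0 F s W)

  tuples-forbid-cons : ∀ c F s W κ → elem c W ≡ false → tuples (c ∷ F) s W κ ≡ tuples F s W (λ u → when (not (elem c u)) (κ u))
  tuples-forbid-cons c F zero W κ h rewrite h = refl
  tuples-forbid-cons c F (suc s) W κ h = sumTo-cong q by-first-colour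
    where
    by-first-colour : ∀ d → d < q → when (not (elem d W) ∧ not ((c ≡ᵇ d) ∨ elem d F)) (tuples (c ∷ F) s (d ∷ W) κ)
                      ≡ when (not (elem d W) ∧ not (elem d F)) (tuples F s (d ∷ W) (λ u → when (not (elem c u)) (κ u)))
    by-first-colour d _ with c ≡ᵇ d in e
    ... | true rewrite ∧-zeroʳ (not (elem d W)) | sym (≡ᵇ-true⇒≡ c d e) =
          sym (trans (cong (when _) (tuples-vanish F s (c ∷ W) _ c (cong (_∨ elem c W) (≡ᵇ-refl c))
                 (λ u eu → cong (λ z → when (not z) (κ u)) eu))) (when-0 _))
    ... | false = cong (when _) (tuples-forbid-cons c F s (d ∷ W) κ (cong₂ _∨_ (trans (≡ᵇ-sym d c) e) h))

  tuples-const : ∀ F s W m → Distinct (W ++ F) → All (_< q) (W ++ F) → tuples F s W (λ _ → m) ≡ ff (q ∸ length (W ++ F)) s * m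
  tuples-const F zero W m d a = sym (+-identityʳ m)
  tuples-const F (suc s) W m d a = begin
    sumTo q (λ c → when (not (elem c W) ∧ not (elem c F)) (tuples F s (c ∷ W) (λ _ → m)))
      ≡⟨ sumTo-cong q by-first-colour ⟩
    sumTo q (λ c → when (not (elem c (W ++ F))) 1 * (ff (q ∸ suc L) s * m))
      ≡⟨ sumTo-*ʳ q _ _ ⟩
    sumTo q (λ c → when (not (elem c (W ++ F))) 1) * (ff (q ∸ suc L) s * m)
      ≡⟨ cong (_* (ff (q ∸ suc L) s * m)) unused-colours ⟩
    (q ∸ L) * (ff (q ∸ suc L) s * m)
      ≡⟨ sym (*-assoc (q ∸ L) _ m) ⟩
    (q ∸ L) * ff (q ∸ suc L) s * m
      ≡⟨ cong (λ z → (q ∸ L) * ff z s * m) (trans (cong (q ∸_) (+-comm 1 L)) (sym (∸-+-assoc q L 1))) ⟩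
    (q ∸ L) * ff (q ∸ L ∸ 1) s * m
      ≡⟨ cong (_* m) (sym (ff-suc-front (q ∸ L) s)) ⟩
    ff (q ∸ L) (suc s) * m ∎
    where
    open ≡-Reasoning
    L = length (W ++ F)
    unused-colours : sumTo q (λ c → when (not (elem c (W ++ F))) 1) ≡ q ∸ L
    unused-colours = trans (sym (m+n∸n≡m _ L)) (cong (_∸ L) (count-unused q (W ++ F) d a))
    by-first-colour : ∀ c → c < q → when (not (elem c W) ∧ not (elem c F)) (tuples F s (c ∷ W) (λ _ → m)) ≡ when (not (elem c (W ++ F))) 1 * (ff (q ∸ suc L) s * m)
    by-first-colour c c<q with elem c W in e₁ | elem c F in e₂
    ... | true | _ rewrite elem-++ c W F | e₁ = refl
    ... | false | true rewrite elem-++ c W F | e₁ | e₂ = refl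
    ... | false | false rewrite elem-++ c W F | e₁ | e₂ =
          trans (tuples-const F s (c ∷ W) m (trans (elem-++ c W F) (cong₂ _∨_ e₁ e₂) , d) (c<q ∷ a)) (sym (+-identityʳ _))

  -- This is the symmetry of an edge between cliques.
  tuples-interchange : ∀ F s W E b (h : List ℕ → List ℕ → ℕ) →
     tuples F s W (λ t → tuples (t ++ E) b [] (h t)) ≡ tuples (W ++ E) b [] (λ u → tuples (F ++ u) s W (λ t → h t u))
  tuples-interchange F zero W E b h = refl
  tuples-interchange F (suc s) W E b h = begin
    sumTo q (λ c → when (β c) (tuples F s (c ∷ W) (λ t → tuples (t ++ E) b [] (h t))))
      ≡⟨ sumTo-cong q (λ c _ → cong (when (β c)) (tuples-interchange F s (c ∷ W) E b h)) ⟩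
    sumTo q (λ c → when (β c) (tuples (c ∷ W ++ E) b [] (λ u → G c u)))
      ≡⟨ sumTo-cong q (λ c _ → by-first-colour c) ⟩
    sumTo q (λ c → tuples (W ++ E) b [] (λ u → when (not (elem c W) ∧ not (elem c (F ++ u))) (G c u)))
      ≡⟨ sym (tuples-Σ (W ++ E) b [] q (λ c u → when (not (elem c W) ∧ not (elem c (F ++ u))) (G c u))) ⟩
    tuples (W ++ E) b [] (λ u → tuples (F ++ u) (suc s) W (λ t → h t u)) ∎
    where
    open ≡-Reasoning
    β = λ c → not (elem c W) ∧ not (elem c F)
    G = λ c u → tuples (F ++ u) s (c ∷ W) (λ t → h t u)
    by-first-colour : ∀ c → when (β c) (tuples (c ∷ W ++ E) b [] (λ u → G c u)) ≡ tuples (W ++ E) b [] (λ u → when (not (elem c W) ∧ not (elem c (F ++ u))) (G c u))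
    by-first-colour c with elem c W in e₁ | elem c F in e₂
    ... | true | _ = sym (tuples-0 (W ++ E) b [])
    ... | false | true = sym (trans (tuples-cong (W ++ E) b [] (λ u → cong (λ z → when (not z) (G c u)) (trans (elem-++ c F u) (cong (_∨ elem c u) e₂)))) (tuples-0 (W ++ E) b []))
    ... | false | false = trans (tuples-forbid-cons c (W ++ E) b [] (λ u → G c u) refl)
            (tuples-cong (W ++ E) b [] (λ u → cong (λ z → when (not z) (G c u)) (sym (trans (elem-++ c F u) (cong (_∨ elem c u) e₂)))))

-- Colourings of a clique-path with block sizes ss whose first block must avoid
-- the colours U and whose last block must avoid the colours V.
module PathCount (q : ℕ) where
  open Tuples q

  pathCount : List ℕ → List ℕ → List ℕ → ℕ
  pathCount U [] V = 1
  pathCount U (s ∷ []) V = tuples (U ++ V) s [] (λ _ → 1)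
  pathCount U (s ∷ s' ∷ ss) V = tuples U s [] (λ t → pathCount t (s' ∷ ss) V)

  pathCount-snoc : ∀ U V s rs → rs ≢ [] → tuples U s [] (λ t → pathCount V rs t) ≡ pathCount V (rs ++ s ∷ []) U
  pathCount-snoc U V s [] ne = ⊥-elim (ne refl)
  pathCount-snoc U V s (r ∷ []) ne = begin
    tuples U s [] (λ t → tuples (V ++ t) r [] (λ _ → 1))
      ≡⟨ tuples-cong U s [] (λ t → tuples-forbid-cong (V ++ t) (t ++ V) r [] _ (elem-++-comm V t)) ⟩
    tuples U s [] (λ t → tuples (t ++ V) r [] (λ _ → 1))
      ≡⟨ tuples-interchange U s [] V r (λ t u → 1) ⟩
    tuples V r [] (λ u → tuples (U ++ u) s [] (λ _ → 1))
      ≡⟨ tuples-cong V r [] (λ u → tuples-forbid-cong (U ++ u) (u ++ U) s [] _ (elem-++-comm U u)) ⟩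
    tuples V r [] (λ u → tuples (u ++ U) s [] (λ _ → 1)) ∎
    where open ≡-Reasoning
  pathCount-snoc U V s (r ∷ r' ∷ rs) ne = begin
    tuples U s [] (λ t → tuples V r [] (λ x → pathCount x (r' ∷ rs) t))
      ≡⟨ tuples-fubini U s [] V r [] (λ t x → pathCount x (r' ∷ rs) t) ⟩
    tuples V r [] (λ x → tuples U s [] (λ t → pathCount x (r' ∷ rs) t))
      ≡⟨ tuples-cong V r [] (λ x → pathCount-snoc U x s (r' ∷ rs) (λ ())) ⟩
    tuples V r [] (λ x → pathCount x (r' ∷ rs ++ s ∷ []) U) ∎
    where open ≡-Reasoning

  pathCount-reverse : ∀ U V ss → pathCount U ss V ≡ pathCount V (reverse ss) U
  pathCount-reverse U V [] = refl
  pathCount-reverse U V (s ∷ []) = tuples-forbid-cong (U ++ V) (V ++ U) s [] _ (elem-++-comm U V)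
  pathCount-reverse U V (s ∷ s' ∷ ss) = begin
    tuples U s [] (λ t → pathCount t (s' ∷ ss) V)
      ≡⟨ tuples-cong U s [] (λ t → pathCount-reverse t V (s' ∷ ss)) ⟩
    tuples U s [] (λ t → pathCount V (reverse (s' ∷ ss)) t)
      ≡⟨ pathCount-snoc U V s (reverse (s' ∷ ss)) ne ⟩
    pathCount V (reverse (s' ∷ ss) ++ s ∷ []) U
      ≡⟨ cong (λ z → pathCount V z U) (sym (unfold-reverse s (s' ∷ ss))) ⟩
    pathCount V (reverse (s ∷ s' ∷ ss)) U ∎
    where
    open ≡-Reasoning
    ne : reverse (s' ∷ ss) ≢ []
    ne e with trans (sym (length-reverse (s' ∷ ss))) (cong length e)
    ... | ()

  -- ffChain m ss = ∏ (q - previous block size)_s, the count of a path started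
  -- after a block of size m.
  ffChain : ℕ → List ℕ → ℕ
  ffChain m [] = 1
  ffChain m (s ∷ ss) = ff (q ∸ m) s * ffChain s ss

  pathCount-open-end : ∀ U ss → Distinct U → All (_< q) U → pathCount U ss [] ≡ ffChain (length U) ss
  pathCount-open-end U [] d a = refl
  pathCount-open-end U (s ∷ []) d a rewrite ++-identityʳ U = tuples-const U s [] 1 d a
  pathCount-open-end U (s ∷ s' ∷ ss) d a = begin
    tuples U s [] (λ t → pathCount t (s' ∷ ss) [])
      ≡⟨ tuples-ext U s [] (λ u g → trans (pathCount-open-end u (s' ∷ ss) (grows-distinct g tt) (grows-bounded g []))
                                       (cong (λ z → ffChain z (s' ∷ ss)) (trans (grows-length g) (+-identityʳ s)))) ⟩
    tuples U s [] (λ _ → ffChain s (s' ∷ ss))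
      ≡⟨ tuples-const U s [] _ d a ⟩
    ff (q ∸ length U) s * ffChain s (s' ∷ ss) ∎
    where open ≡-Reasoning

  pathCount-close : ∀ ks ss k → Distinct ks → All (_< q) ks → length ks ≡ k →
       pathCount [] (ss ++ k ∷ []) [] ≡ ff q k * pathCount [] ss ks
  pathCount-close ks ss k d a lk = begin
    pathCount [] (ss ++ k ∷ []) []
      ≡⟨ pathCount-reverse [] [] (ss ++ k ∷ []) ⟩
    pathCount [] (reverse (ss ++ k ∷ [])) []
      ≡⟨ cong (λ z → pathCount [] z []) (reverse-++ ss (k ∷ [])) ⟩
    pathCount [] (k ∷ reverse ss) []
      ≡⟨ pathCount-open-end [] (k ∷ reverse ss) tt [] ⟩
    ff q k * ffChain k (reverse ss)
      ≡⟨ cong (λ z → ff q k * ffChain z (reverse ss)) (sym lk) ⟩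
    ff q k * ffChain (length ks) (reverse ss)
      ≡⟨ cong (ff q k *_) (sym (pathCount-open-end ks (reverse ss) d a)) ⟩
    ff q k * pathCount ks (reverse ss) []
      ≡⟨ cong (ff q k *_) (sym (pathCount-reverse [] ks ss)) ⟩
    ff q k * pathCount [] ss ks ∎
    where open ≡-Reasoning

-- The recurrence for one arm of the theta graph.  Throughout, c0 is the colour
-- of the initial vertex, a and b are the sizes of the first two blocks of the arm.
module Recurrence (q : ℕ) where
  open Tuples q
  open PathCount q

  -- Colourings of
  -- the first block avoiding u, compared with those also avoiding c0: if c0 ∈ u
  -- there is no difference, otherwise the difference is accounted for by ff-split.
  avoid-c0-given-second : ∀ c0 a b u h → c0 < q → Distinct u → All (_< q) u → length u ≡ b →
    tuples u a [] (λ _ → h) * ff q (suc b)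
    ≡ tuples (c0 ∷ u) a [] (λ _ → h) * ff q (suc b) + when (not (elem c0 u)) h * (a * ff q (a + b))
  avoid-c0-given-second c0 a b u h c0<q du au lu with elem c0 u in c0∈u
  ... | true = trans (cong (_* B1) (tuples-forbid-cong u (c0 ∷ u) a [] _ same-members)) (sym (+-identityʳ _))
    where
    B1 = ff q (suc b)
    same-members : ∀ x → elem x u ≡ elem x (c0 ∷ u)
    same-members x with c0 ≡ᵇ x in e
    ... | true rewrite sym (≡ᵇ-true⇒≡ c0 x e) = c0∈u
    ... | false = refl
  ... | false = begin
    tuples u a [] (λ _ → h) * B1
      ≡⟨ cong (_* B1) (tuples-const u a [] h du au) ⟩
    ff (q ∸ length u) a * h * B1
      ≡⟨ cong (λ z → ff (q ∸ z) a * h * B1) lu ⟩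
    ff (q ∸ b) a * h * B1
      ≡⟨ solve 3 (λ X h B → X :* h :* B := h :* (X :* B)) refl (ff (q ∸ b) a) h B1 ⟩
    h * (ff (q ∸ b) a * B1)
      ≡⟨ cong (h *_) (ff-split q a b) ⟩
    h * (ff (q ∸ suc b) a * B1 + aA)
      ≡⟨ solve 4 (λ X h B A → h :* (X :* B :+ A) := X :* h :* B :+ h :* A) refl (ff (q ∸ suc b) a) h B1 aA ⟩
    ff (q ∸ suc b) a * h * B1 + h * aA
      ≡⟨ cong (λ z → ff (q ∸ z) a * h * B1 + h * aA) (sym (cong suc lu)) ⟩
    ff (q ∸ length (c0 ∷ u)) a * h * B1 + h * aA
      ≡⟨ cong (λ z → z * B1 + h * aA) (sym (tuples-const (c0 ∷ u) a [] h (c0∈u , du) (c0<q ∷ au))) ⟩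
    tuples (c0 ∷ u) a [] (λ _ → h) * B1 + h * aA ∎
    where
    open ≡-Reasoning
    open +-*-Solver
    B1 = ff q (suc b)
    aA = a * ff q (a + b)

  -- Two adjacent blocks of sizes a and b, the second one followed by a weight H:
  -- summing avoid-c0-given-second over the colourings u of the second block.
  split-first-block : ∀ c0 a b E (H : List ℕ → ℕ) → c0 < q →
    tuples [] a [] (λ t → tuples (t ++ E) b [] H) * ff q (suc b)
    ≡ tuples (c0 ∷ []) a [] (λ t → tuples (t ++ E) b [] H) * ff q (suc b) + a * ff q (a + b) * tuples (c0 ∷ E) b [] H
  split-first-block c0 a b E H c0<q = begin
    tuples [] a [] (λ t → tuples (t ++ E) b [] H) * B1
      ≡⟨ cong (_* B1) (tuples-interchange [] a [] E b (λ t → H)) ⟩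
    tuples E b [] (λ u → tuples u a [] (λ _ → H u)) * B1
      ≡⟨ sym (tuples-*ʳ E b [] _ B1) ⟩
    tuples E b [] (λ u → tuples u a [] (λ _ → H u) * B1)
      ≡⟨ tuples-ext E b [] (λ u g → avoid-c0-given-second c0 a b u (H u) c0<q
                                      (grows-distinct g tt) (grows-bounded g []) (trans (grows-length g) (+-identityʳ b))) ⟩
    tuples E b [] (λ u → tuples (c0 ∷ u) a [] (λ _ → H u) * B1 + when (not (elem c0 u)) (H u) * aA)
      ≡⟨ tuples-+ E b [] _ _ ⟩
    tuples E b [] (λ u → tuples (c0 ∷ u) a [] (λ _ → H u) * B1) + tuples E b [] (λ u → when (not (elem c0 u)) (H u) * aA)
      ≡⟨ cong₂ _+_ (tuples-*ʳ E b [] _ B1) (tuples-*ʳ E b [] _ aA) ⟩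
    tuples E b [] (λ u → tuples (c0 ∷ u) a [] (λ _ → H u)) * B1 + tuples E b [] (λ u → when (not (elem c0 u)) (H u)) * aA
      ≡⟨ cong₂ _+_ (cong (_* B1) (sym (tuples-interchange (c0 ∷ []) a [] E b (λ t → H))))
                   (trans (cong (_* aA) (sym (tuples-forbid-cons c0 E b [] H refl))) (*-comm _ aA)) ⟩
    tuples (c0 ∷ []) a [] (λ t → tuples (t ++ E) b [] H) * B1 + aA * tuples (c0 ∷ E) b [] H ∎
    where
    open ≡-Reasoning
    B1 = ff q (suc b)
    aA = a * ff q (a + b)

  -- pathCount with the second block singled out: the rest of the path is a
  -- weight on the colours of the second block, or (for a two-block path) the
  -- second block itself must also avoid the end constraint V.
  tailAvoid : List ℕ → List ℕ → List ℕ
  tailAvoid [] V = V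
  tailAvoid (_ ∷ _) V = []

  tailCount : List ℕ → List ℕ → List ℕ → ℕ
  tailCount [] V = λ _ → 1
  tailCount (r ∷ rs) V = λ u → pathCount u (r ∷ rs) V

  pathCount-unfold : ∀ t b rest V → pathCount t (b ∷ rest) V ≡ tuples (t ++ tailAvoid rest V) b [] (tailCount rest V)
  pathCount-unfold t b [] V = refl
  pathCount-unfold t b (r ∷ rs) V = tuples-forbid-cong t (t ++ []) b [] _ (λ x → cong (elem x) (sym (++-identityʳ t)))

  pathCount-split : ∀ c0 a b rest V → c0 < q →
    pathCount [] (a ∷ b ∷ rest) V * ff q (suc b)
    ≡ pathCount (c0 ∷ []) (a ∷ b ∷ rest) V * ff q (suc b) + a * ff q (a + b) * pathCount (c0 ∷ []) (b ∷ rest) V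
  pathCount-split c0 a b rest V c0<q = begin
    pathCount [] (a ∷ b ∷ rest) V * B1
      ≡⟨ cong (_* B1) (tuples-cong [] a [] (λ t → pathCount-unfold t b rest V)) ⟩
    tuples [] a [] (λ t → tuples (t ++ E) b [] H) * B1
      ≡⟨ split-first-block c0 a b E H c0<q ⟩
    tuples (c0 ∷ []) a [] (λ t → tuples (t ++ E) b [] H) * B1 + aA * tuples (c0 ∷ E) b [] H
      ≡⟨ cong₂ (λ z w → z * B1 + aA * w) (sym (tuples-cong (c0 ∷ []) a [] (λ t → pathCount-unfold t b rest V)))
                                          (sym (pathCount-unfold (c0 ∷ []) b rest V)) ⟩
    pathCount (c0 ∷ []) (a ∷ b ∷ rest) V * B1 + aA * pathCount (c0 ∷ []) (b ∷ rest) V ∎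
    where
    open ≡-Reasoning
    E = tailAvoid rest V
    H = tailCount rest V
    B1 = ff q (suc b)
    aA = a * ff q (a + b)

  pathCount-recurrence : ∀ c0 a b rest k ks → c0 < q → Distinct ks → All (_< q) ks → length ks ≡ k →
     pathCount (c0 ∷ []) (a ∷ b ∷ rest) ks * ff q k * ff q (suc b) + a * ff q (a + b) * pathCount (c0 ∷ []) (b ∷ rest) ks * ff q k
     ≡ pathCount [] (a ∷ b ∷ rest ++ k ∷ []) [] * ff q (suc b)
  pathCount-recurrence c0 a b rest k ks c0<q d al lk = begin
    X * FK * B1 + aA * Xb * FK
      ≡⟨ solve 5 (λ X FK B1 aA Xb → X :* FK :* B1 :+ aA :* Xb :* FK := FK :* (X :* B1 :+ aA :* Xb)) refl X FK B1 aA Xb ⟩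
    FK * (X * B1 + aA * Xb)
      ≡⟨ cong (FK *_) (sym (pathCount-split c0 a b rest ks c0<q)) ⟩
    FK * (C * B1)
      ≡⟨ sym (*-assoc FK C B1) ⟩
    FK * C * B1
      ≡⟨ cong (_* B1) (sym (pathCount-close ks (a ∷ b ∷ rest) k d al lk)) ⟩
    pathCount [] (a ∷ b ∷ rest ++ k ∷ []) [] * B1 ∎
    where
    open ≡-Reasoning
    open +-*-Solver
    X = pathCount (c0 ∷ []) (a ∷ b ∷ rest) ks
    Xb = pathCount (c0 ∷ []) (b ∷ rest) ks
    C = pathCount [] (a ∷ b ∷ rest) ks
    FK = ff q k
    B1 = ff q (suc b)
    aA = a * ff q (a + b)

-- Graphs whose vertices are pairs (block , position), as produced by blowUp.
-- A clique block coloured vertex by vertex is an injective colour tuple.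
module Blocks (q : ℕ) (adj : ℕ × ℕ → ℕ × ℕ → Bool) where
  open Cnt q adj
  open CntProperties q adj
  open Tuples q

  -- the context after colouring positions 0,1,… of block β with the colours W
  -- (most recent first)
  blockCtx : ℕ → List ℕ → List ((ℕ × ℕ) × ℕ)
  blockCtx β [] = []
  blockCtx β (w ∷ W) = ((β , length W) , w) ∷ blockCtx β W

  ok-block : ∀ β W v c b → (∀ p → adj (β , p) v ≡ b) → ok (blockCtx β W) v c ≡ not (b ∧ elem c W)
  ok-block β [] v c b h = sym (cong not (∧-zeroʳ b))
  ok-block β (w ∷ W) v c b h rewrite ok-block β W v c b (λ p → h p) | h (length W) = not-∧-∨ b (w ≡ᵇ c) (elem c W)
    where
    not-∧-∨ : ∀ b x y → not (b ∧ x) ∧ not (b ∧ y) ≡ not (b ∧ (x ∨ y))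
    not-∧-∨ true true y = refl
    not-∧-∨ true false y = refl
    not-∧-∨ false x y = refl

  CliqueBlocks : Set
  CliqueBlocks = ∀ b p p' → adj (b , p) (b , p') ≡ not (p ≡ᵇ p')

  ok-own-block : CliqueBlocks → ∀ β W p c → length W ≤ p → ok (blockCtx β W) (β , p) c ≡ not (elem c W)
  ok-own-block hs β [] p c le = refl
  ok-own-block hs β (w ∷ W) p c le rewrite ok-own-block hs β W p c (≤-trans (n≤1+n _) le) | hs β (length W) p
    | ≢⇒≡ᵇ-false (length W) p (<⇒≢ le) = sym (not-∨ (w ≡ᵇ c) (elem c W))

  cnt-clique : CliqueBlocks → ∀ β F Δ (κ : List ((ℕ × ℕ) × ℕ) → ℕ) → (∀ p c → ok Δ (β , p) c ≡ not (elem c F)) →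
       ∀ s W (f : ℕ → ℕ) → (∀ i → f i ≡ length W + i) →
       cntK (blockCtx β W ++ Δ) (map (λ p → (β , p)) (applyUpTo f s)) κ ≡ tuples F s W (λ t → κ (blockCtx β t ++ Δ))
  cnt-clique hs β F Δ κ hΔ zero W f hf = refl
  cnt-clique hs β F Δ κ hΔ (suc s) W f hf = begin
    sumTo q (λ c → when (ok (blockCtx β W ++ Δ) (β , f 0) c) (cntK (((β , f 0) , c) ∷ blockCtx β W ++ Δ) rest κ))
      ≡⟨ cong (λ p → sumTo q (λ c → when (ok (blockCtx β W ++ Δ) (β , p) c) (cntK (((β , p) , c) ∷ blockCtx β W ++ Δ) rest κ)))
              (trans (hf 0) (+-identityʳ (length W))) ⟩
    sumTo q (λ c → when (ok (blockCtx β W ++ Δ) (β , length W) c) (cntK (blockCtx β (c ∷ W) ++ Δ) rest κ))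
      ≡⟨ sumTo-cong q (λ c _ → cong₂ when (trans (ok-++ (blockCtx β W) Δ (β , length W) c)
                                              (cong₂ _∧_ (ok-own-block hs β W (length W) c ≤-refl) (hΔ (length W) c)))
                                        (cnt-clique hs β F Δ κ hΔ s (c ∷ W) (λ i → f (suc i)) (λ i → trans (hf (suc i)) (+-suc (length W) i)))) ⟩
    tuples F (suc s) W (λ t → κ (blockCtx β t ++ Δ)) ∎
    where
    open ≡-Reasoning
    rest = map (λ p → (β , p)) (applyUpTo (λ i → f (suc i)) s)

chainVerts : ℕ → List ℕ → List (ℕ × ℕ)
chainVerts β [] = []
chainVerts β (s ∷ S) = map (λ p → (β , p)) (upTo s) ++ chainVerts (suc β) S

-- A clique-path in which block i must moreover avoid the colours F i; the
-- first block also avoids W.  pathCount is the special case in which only the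
-- end blocks carry constraints (pathCount≡pathCountAt).
module PathCountAt (q : ℕ) where
  open Tuples q
  open PathCount q

  pathCountAt : List ℕ → (ℕ → List ℕ) → List ℕ → ℕ
  pathCountAt W F [] = 1
  pathCountAt W F (s ∷ S) = tuples (W ++ F 0) s [] (λ t → pathCountAt t (λ i → F (suc i)) S)

  pathCountAt-cong : ∀ W W' F F' S → (0 < length S → ∀ x → elem x (W ++ F 0) ≡ elem x (W' ++ F' 0)) →
     (∀ i → suc i < length S → ∀ x → elem x (F (suc i)) ≡ elem x (F' (suc i))) →
     pathCountAt W F S ≡ pathCountAt W' F' S
  pathCountAt-cong W W' F F' [] h1 h2 = refl
  pathCountAt-cong W W' F F' (s ∷ S) h1 h2 = trans (tuples-forbid-cong (W ++ F 0) (W' ++ F' 0) s [] _ (h1 (s≤s z≤n)))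
     (tuples-cong (W' ++ F' 0) s [] (λ t → pathCountAt-cong t t (λ i → F (suc i)) (λ i → F' (suc i)) S
        (λ pos x → trans (elem-++ x t _) (trans (cong (elem x t ∨_) (h2 0 (s≤s pos) x)) (sym (elem-++ x t _))))
        (λ i i< x → h2 (suc i) (s≤s i<) x)))

  -- the constraints of pathCount U S V, block by block (m = number of blocks)
  endAvoid : List ℕ → List ℕ → ℕ → ℕ → List ℕ
  endAvoid U V m i = (if i ≡ᵇ 0 then U else []) ++ (if suc i ≡ᵇ m then V else [])

  pathCount≡pathCountAt : ∀ U V S → pathCount U S V ≡ pathCountAt [] (endAvoid U V (length S)) S
  pathCount≡pathCountAt U V [] = refl
  pathCount≡pathCountAt U V (s ∷ []) = refl
  pathCount≡pathCountAt U V (s ∷ s' ∷ ss) = trans (tuples-cong U s [] (λ t → pathCount≡pathCountAt t V (s' ∷ ss)))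
     (trans (tuples-forbid-cong U (U ++ []) s [] _ (λ x → cong (elem x) (sym (++-identityʳ U))))
        (tuples-cong (U ++ []) s [] (λ t → pathCountAt-cong [] t (endAvoid t V (suc (length ss))) (λ i → endAvoid U V (suc (suc (length ss))) (suc i)) (s' ∷ ss)
           (λ _ x → refl) (λ i _ x → refl))))

module ChainColourings (q : ℕ) (adj : ℕ × ℕ → ℕ × ℕ → Bool) where
  open Cnt q adj
  open CntProperties q adj
  open Tuples q
  open Blocks q adj
  open PathCountAt q

  -- Colouring the blocks β, β+1, … (sizes S) of a clique-path living inside the
  -- blocks below e, in a context P ++ Δ where
  --   joined/apart: consecutive blocks are completely joined, blocks at distance
  --     ≥ 2 are non-adjacent;
  --   at-first/not-beyond: P (the previously coloured path blocks) constrains the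
  --     first block by the colours W and no later block;
  --   outside: Δ (vertices outside the path) constrains block β+i by F i.
  cnt-chain : CliqueBlocks → ∀ (e : ℕ) S β W F P Δ →
    β + length S ≤ e →
    (∀ j → β ≤ j → suc j < e → ∀ p p' → adj (j , p) (suc j , p') ≡ true) →
    (∀ j j' → β ≤ j → suc (suc j) ≤ j' → j' < e → ∀ p p' → adj (j , p) (j' , p') ≡ false) →
    (0 < length S → ∀ p c → ok P (β , p) c ≡ not (elem c W)) →
    (∀ j p c → suc β ≤ j → j < e → ok P (j , p) c ≡ true) →
    (∀ i p c → i < length S → ok Δ (β + i , p) c ≡ not (elem c (F i))) →
    cnt (P ++ Δ) (chainVerts β S) ≡ pathCountAt W F S
  cnt-chain hs e [] β W F P Δ fits joined apart at-first not-beyond outside = refl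
  cnt-chain hs e (s ∷ S) β W F P Δ fits joined apart at-first not-beyond outside = begin
    cntK (P ++ Δ) (block ++ chainVerts (suc β) S) (λ _ → 1)
      ≡⟨ cntK-++ (P ++ Δ) block (chainVerts (suc β) S) (λ _ → 1) ⟩
    cntK (P ++ Δ) block (λ Γ → cnt Γ (chainVerts (suc β) S))
      ≡⟨ cnt-clique hs β (W ++ F 0) (P ++ Δ) (λ Γ → cnt Γ (chainVerts (suc β) S)) first-block s [] (λ i → i) (λ i → refl) ⟩
    tuples (W ++ F 0) s [] (λ t → cnt (blockCtx β t ++ (P ++ Δ)) (chainVerts (suc β) S))
      ≡⟨ tuples-cong (W ++ F 0) s [] rest-of-chain ⟩
    pathCountAt W F (s ∷ S) ∎
    where
    open ≡-Reasoning
    block = map (λ p → (β , p)) (upTo s)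
    fits' : suc β + length S ≤ e
    fits' = subst (_≤ e) (+-suc β (length S)) fits
    second-exists : 0 < length S → suc β < e
    second-exists pos = ≤-trans (s≤s (subst (suc β ≤_) (+-comm (length S) β) (+-monoˡ-≤ β pos))) fits'
    in-chain : ∀ i → i < length S → suc β + i < e
    in-chain i i< = ≤-trans (+-monoʳ-< (suc β) i<) fits'
    first-block : ∀ p c → ok (P ++ Δ) (β , p) c ≡ not (elem c (W ++ F 0))
    first-block p c = begin
      ok (P ++ Δ) (β , p) c
        ≡⟨ ok-++ P Δ (β , p) c ⟩
      ok P (β , p) c ∧ ok Δ (β , p) c
        ≡⟨ cong₂ _∧_ (at-first (s≤s z≤n) p c) (subst (λ z → ok Δ (z , p) c ≡ not (elem c (F 0))) (+-identityʳ β) (outside 0 p c (s≤s z≤n))) ⟩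
      not (elem c W) ∧ not (elem c (F 0))
        ≡⟨ sym (not-∨ (elem c W) (elem c (F 0))) ⟩
      not (elem c W ∨ elem c (F 0))
        ≡⟨ cong not (sym (elem-++ c W (F 0))) ⟩
      not (elem c (W ++ F 0)) ∎
    rest-of-chain : ∀ t → cnt (blockCtx β t ++ (P ++ Δ)) (chainVerts (suc β) S) ≡ pathCountAt t (λ i → F (suc i)) S
    rest-of-chain t = cnt-chain hs e S (suc β) t (λ i → F (suc i)) (blockCtx β t) (P ++ Δ) fits'
      (λ j βj je → joined j (≤-trans (n≤1+n β) βj) je)
      (λ j j' βj jj' j'e → apart j j' (≤-trans (n≤1+n β) βj) jj' j'e)
      (λ pos p c → ok-block β t (suc β , p) c true (λ p' → joined β ≤-refl (second-exists pos) p' p))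
      (λ j p c βj je → ok-block β t (j , p) c false (λ p' → apart β j ≤-refl βj je p' p))
      (λ i p c i< → trans (ok-++ P Δ (suc β + i , p) c)
         (cong₂ _∧_ (not-beyond (suc β + i) p c (s≤s (m≤m+n β i)) (in-chain i i<))
                    (subst (λ z → ok Δ (z , p) c ≡ not (elem c (F (suc i)))) (+-suc β i) (outside (suc i) p c (s≤s i<)))))

edgeIn-++ : ∀ E1 E2 b b' → edgeIn (E1 ++ E2) b b' ≡ edgeIn E1 b b' ∨ edgeIn E2 b b'
edgeIn-++ [] E2 b b' = refl
edgeIn-++ ((x , y) ∷ E1) E2 b b' = trans (cong (hit ∨_) (edgeIn-++ E1 E2 b b')) (sym (∨-assoc hit (edgeIn E1 b b') (edgeIn E2 b b')))
  where hit = ((x ≡ᵇ b) ∧ (y ≡ᵇ b')) ∨ ((x ≡ᵇ b') ∧ (y ≡ᵇ b))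

edgeIn-mem : ∀ E b b' → (b , b') ∈ E → edgeIn E b b' ≡ true
edgeIn-mem ((x , y) ∷ E) b b' (here refl) rewrite ≡ᵇ-refl b | ≡ᵇ-refl b' = refl
edgeIn-mem ((x , y) ∷ E) b b' (there m) = trans (cong ((((x ≡ᵇ b) ∧ (y ≡ᵇ b')) ∨ ((x ≡ᵇ b') ∧ (y ≡ᵇ b))) ∨_) (edgeIn-mem E b b' m)) (∨-zeroʳ _)

edgeIn-memʳ : ∀ E b b' → (b' , b) ∈ E → edgeIn E b b' ≡ true
edgeIn-memʳ ((x , y) ∷ E) b b' (here refl) rewrite ≡ᵇ-refl b | ≡ᵇ-refl b' = cong (_∨ edgeIn E b b') (∨-zeroʳ ((b' ≡ᵇ b) ∧ (b ≡ᵇ b')))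
edgeIn-memʳ ((x , y) ∷ E) b b' (there m) = trans (cong ((((x ≡ᵇ b) ∧ (y ≡ᵇ b')) ∨ ((x ≡ᵇ b') ∧ (y ≡ᵇ b))) ∨_) (edgeIn-memʳ E b b' m)) (∨-zeroʳ _)

∧-≡ᵇ-false : ∀ x y b b' → ¬ (x ≡ b × y ≡ b') → ((x ≡ᵇ b) ∧ (y ≡ᵇ b')) ≡ false
∧-≡ᵇ-false x y b b' h with x ≡ᵇ b in e1 | y ≡ᵇ b' in e2
... | false | _ = refl
... | true | false = refl
... | true | true = ⊥-elim (h (≡ᵇ-true⇒≡ x b e1 , ≡ᵇ-true⇒≡ y b' e2))

edgeIn-none : ∀ E b b' → (∀ x y → (x , y) ∈ E → ¬ (x ≡ b × y ≡ b') × ¬ (x ≡ b' × y ≡ b)) → edgeIn E b b' ≡ false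
edgeIn-none [] b b' h = refl
edgeIn-none ((x , y) ∷ E) b b' h = cong₂ _∨_ (cong₂ _∨_ (∧-≡ᵇ-false x y b b' (proj₁ (h x y (here refl)))) (∧-≡ᵇ-false x y b' b (proj₂ (h x y (here refl)))))
  (edgeIn-none E b b' (λ x' y' m → h x' y' (there m)))

NotEnd : ℕ → List (ℕ × ℕ) → Set
NotEnd b E = ∀ x y → (x , y) ∈ E → x ≢ b × y ≢ b

notEnd-l : ∀ E b b' → NotEnd b E → edgeIn E b b' ≡ false
notEnd-l E b b' h = edgeIn-none E b b' (λ x y m → (λ p → proj₁ (h x y m) (proj₁ p)) , (λ p → proj₂ (h x y m) (proj₂ p)))

notEnd-r : ∀ E b b' → NotEnd b' E → edgeIn E b b' ≡ false
notEnd-r E b b' h = edgeIn-none E b b' (λ x y m → (λ p → proj₂ (h x y m) (proj₂ p)) , (λ p → proj₁ (h x y m) (proj₁ p)))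

NotEnd-++ : ∀ b E1 E2 → NotEnd b E1 → NotEnd b E2 → NotEnd b (E1 ++ E2)
NotEnd-++ b E1 E2 h1 h2 x y m with ∈-++⁻ E1 m
... | inj₁ m1 = h1 x y m1
... | inj₂ m2 = h2 x y m2

consecutive : ℕ → ℕ → ℕ × ℕ
consecutive o j = (o + j , o + suc j)

consec-shape : ∀ o m x y → (x , y) ∈ map (λ j → (o + j , o + suc j)) (upTo m) → Σ ℕ λ l → l < m × x ≡ o + l × y ≡ o + suc l
consec-shape o m x y mem with ∈-map⁻ (consecutive o) mem
... | l , l∈ , eq = l , ∈-upTo⁻ l∈ , proj₁ (,-injective eq) , proj₂ (,-injective eq)

consec-mem : ∀ o m l → l < m → (o + l , o + suc l) ∈ map (λ j → (o + j , o + suc j)) (upTo m)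
consec-mem o m l l<m = ∈-map⁺ (consecutive o) (∈-upTo⁺ l<m)

ge2≢0 : ∀ {x} → 2 ≤ x → x ≢ 0
ge2≢0 (s≤s _) ()

ge2≢1 : ∀ {x} → 2 ≤ x → x ≢ 1
ge2≢1 (s≤s (s≤s _)) ()

data PathEdgeShape (o m x y : ℕ) : Set where
  to-first : x ≡ 0 → y ≡ o → PathEdgeShape o m x y
  from-last : y ≡ 1 → suc x ≡ o + m → PathEdgeShape o m x y
  inner : ∀ l → suc l < m → x ≡ o + l → y ≡ o + suc l → PathEdgeShape o m x y

pathEdges-shape : ∀ o m x y → (x , y) ∈ pathEdges o m → PathEdgeShape o m x y
pathEdges-shape o (suc m) x y (here refl) = to-first refl refl
pathEdges-shape o (suc m) x y (there (here refl)) = from-last refl (sym (+-suc o m))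
pathEdges-shape o (suc m) x y (there (there mem)) with consec-shape o m x y mem
... | l , l<m , e1 , e2 = inner l (s≤s l<m) e1 e2

pathEdges-nonempty : ∀ o m x y → (x , y) ∈ pathEdges o m → 0 < m
pathEdges-nonempty o (suc m) x y _ = s≤s z≤n

Region : ℕ → ℕ → ℕ → Set
Region lo hi z = z ≤ 1 ⊎ (lo ≤ z × z < hi)

pathEdges-region : ∀ o m x y → 2 ≤ o → (x , y) ∈ pathEdges o m → Region o (o + m) x × Region o (o + m) y × (2 ≤ x ⊎ 2 ≤ y) × x ≢ y
pathEdges-region o m x y o2 mem with pathEdges-shape o m x y mem | pathEdges-nonempty o m x y mem
... | to-first refl refl | pos = inj₁ z≤n , inj₂ (≤-refl , m<m+n o pos) , inj₂ o2 , λ e → ge2≢0 o2 (sym e)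
... | from-last refl e | pos = inj₂ (o≤x , ≤-reflexive e) , inj₁ ≤-refl , inj₁ (≤-trans o2 o≤x) , ge2≢1 (≤-trans o2 o≤x)
  where
  o≤x : o ≤ x
  o≤x = ≤-pred (subst₂ _≤_ (+-comm o 1) (sym e) (+-monoʳ-≤ o pos))
... | inner l l< refl refl | pos = inj₂ (m≤m+n o l , +-monoʳ-< o (<-trans (n<1+n l) l<)) , inj₂ (m≤m+n o (suc l) , +-monoʳ-< o l<) ,
      inj₁ (≤-trans o2 (m≤m+n o l)) , λ eq → 1+n≢n (sym (trans eq (+-suc o l)))

thetaEdges-region : ∀ o Ss x y → 2 ≤ o → (x , y) ∈ thetaEdges o Ss →
   (x ≤ 1 ⊎ o ≤ x) × (y ≤ 1 ⊎ o ≤ y) × (2 ≤ x ⊎ 2 ≤ y) × x ≢ y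
thetaEdges-region o (S ∷ Ss) x y o2 mem with ∈-++⁻ (pathEdges o (length S)) mem
... | inj₁ m1 with pathEdges-region o (length S) x y o2 m1
...   | rx , ry , r2 , ne = f rx , f ry , r2 , ne
  where f : ∀ {z} → Region o (o + length S) z → z ≤ 1 ⊎ o ≤ z
        f (inj₁ z≤1) = inj₁ z≤1
        f (inj₂ (lo , _)) = inj₂ lo
thetaEdges-region o (S ∷ Ss) x y o2 mem | inj₂ m2 with thetaEdges-region (o + length S) Ss x y (≤-trans o2 (m≤m+n o _)) m2
... | rx , ry , r2 , ne = f rx , f ry , r2 , ne
  where f : ∀ {z} → z ≤ 1 ⊎ o + length S ≤ z → z ≤ 1 ⊎ o ≤ z
        f (inj₁ z≤1) = inj₁ z≤1
        f (inj₂ lo) = inj₂ (≤-trans (m≤m+n o _) lo)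

thetaEdges-notEnd : ∀ o Ss b → 2 ≤ o → 2 ≤ b → b < o → NotEnd b (thetaEdges o Ss)
thetaEdges-notEnd o Ss b o2 b2 b<o x y mem with thetaEdges-region o Ss x y o2 mem
... | rx , ry , _ = g rx , g ry
  where g : ∀ {z} → z ≤ 1 ⊎ o ≤ z → z ≢ b
        g (inj₁ z≤1) refl = ge2≢1 b2 (≤-antisym z≤1 (≤-trans (s≤s z≤n) b2))
        g (inj₂ lo) refl = <⇒≱ b<o lo

pathEdges-notEnd-above : ∀ o m b → 2 ≤ o → o + m ≤ b → NotEnd b (pathEdges o m)
pathEdges-notEnd-above o m b o2 hb x y mem with pathEdges-region o m x y o2 mem
... | rx , ry , _ = g rx , g ry
  where g : ∀ {z} → Region o (o + m) z → z ≢ b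
        g (inj₁ z≤1) refl = <⇒≱ (s≤s z≤1) (≤-trans o2 (≤-trans (m≤m+n o m) hb))
        g (inj₂ (_ , hi)) refl = <⇒≱ hi hb

thetaEdges-noloop : ∀ o Ss b → 2 ≤ o → edgeIn (thetaEdges o Ss) b b ≡ false
thetaEdges-noloop o Ss b o2 = edgeIn-none _ b b (λ x y mem → (λ p → ne x y mem (trans (proj₁ p) (sym (proj₂ p)))) , (λ p → ne x y mem (trans (proj₁ p) (sym (proj₂ p)))))
  where ne : ∀ x y → (x , y) ∈ thetaEdges o Ss → x ≢ y
        ne x y mem = proj₂ (proj₂ (proj₂ (thetaEdges-region o Ss x y o2 mem)))

thetaEdges-01 : ∀ o Ss → 2 ≤ o → edgeIn (thetaEdges o Ss) 0 1 ≡ false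
thetaEdges-01 o Ss o2 = edgeIn-none _ 0 1 (λ x y mem → f x y mem)
  where
  f : ∀ x y → (x , y) ∈ thetaEdges o Ss → ¬ (x ≡ 0 × y ≡ 1) × ¬ (x ≡ 1 × y ≡ 0)
  f x y mem with proj₁ (proj₂ (proj₂ (thetaEdges-region o Ss x y o2 mem)))
  ... | inj₁ x2 = (λ p → ge2≢0 x2 (proj₁ p)) , (λ p → ge2≢1 x2 (proj₁ p))
  ... | inj₂ y2 = (λ p → ge2≢1 y2 (proj₂ p)) , (λ p → ge2≢0 y2 (proj₂ p))

armsVerts : ℕ → List (List ℕ) → List (ℕ × ℕ)
armsVerts o [] = []
armsVerts o (S ∷ Ss) = chainVerts o S ++ armsVerts (o + length S) Ss

chainVerts-range : ∀ β S b p → (b , p) ∈ chainVerts β S → β ≤ b × b < β + length S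
chainVerts-range β (s ∷ S) b p mem with ∈-++⁻ (map (λ p → (β , p)) (upTo s)) mem
... | inj₁ m1 with ∈-map⁻ (λ p → (β , p)) m1
...   | _ , _ , eq rewrite proj₁ (,-injective eq) = ≤-refl , m<m+n β (s≤s z≤n)
chainVerts-range β (s ∷ S) b p mem | inj₂ m2 with chainVerts-range (suc β) S b p m2
... | lo , hi = ≤-trans (n≤1+n β) lo , subst (b <_) (sym (+-suc β (length S))) hi

armsVerts-range : ∀ o Ss b p → (b , p) ∈ armsVerts o Ss → o ≤ b
armsVerts-range o (S ∷ Ss) b p mem with ∈-++⁻ (chainVerts o S) mem
... | inj₁ m1 = proj₁ (chainVerts-range o S b p m1)
... | inj₂ m2 = ≤-trans (m≤m+n o _) (armsVerts-range (o + length S) Ss b p m2)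

-- the constraint on an arm block from the initial vertex (colour x, present iff
-- b0) and the final clique (colours y, present iff b1)
not-guarded-∨ : ∀ b0 b1 x y → not (b1 ∧ y) ∧ (not (b0 ∧ x) ∧ true) ≡ not ((if b0 then x ∨ false else false) ∨ (if b1 then y else false))
not-guarded-∨ true true true y = ∧-zeroʳ (not y)
not-guarded-∨ true true false y = ∧-identityʳ (not y)
not-guarded-∨ true false true y = refl
not-guarded-∨ true false false y = refl
not-guarded-∨ false true x y = ∧-identityʳ (not y)
not-guarded-∨ false false x y = refl

elem-if-singleton : ∀ b c c0 → elem c (if b then c0 ∷ [] else []) ≡ (if b then (c0 ≡ᵇ c) ∨ false else false)
elem-if-singleton true c c0 = refl
elem-if-singleton false c c0 = refl

elem-if : ∀ b c ks → elem c (if b then ks else []) ≡ (if b then elem c ks else false)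
elem-if true c ks = refl
elem-if false c ks = refl

∨₃-false : ∀ {a b c} → a ≡ false → b ≡ false → c ≡ false → a ∨ (b ∨ c) ≡ false
∨₃-false refl refl refl = refl

module ThetaColourings (q : ℕ) (Ss₀ : List (List ℕ)) (k : ℕ) where
  E : List (ℕ × ℕ)
  E = thetaEdges 2 Ss₀
  adjT : ℕ × ℕ → ℕ × ℕ → Bool
  adjT = Graph.adj (cliqueTheta Ss₀ k)

  open Cnt q adjT
  open CntProperties q adjT
  open Blocks q adjT
  open ChainColourings q adjT
  open PathCount q
  open PathCountAt q

  adjT-diff : ∀ b b' p p' → b ≢ b' → adjT (b , p) (b' , p') ≡ edgeIn E b b'
  adjT-diff b b' p p' ne rewrite ≢⇒≡ᵇ-false b b' ne = refl

  theta-cliqueBlocks : CliqueBlocks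
  theta-cliqueBlocks b p p' rewrite ≡ᵇ-refl b | thetaEdges-noloop 2 Ss₀ b ≤-refl = ∨-identityʳ _

  ends : ℕ → List ℕ → List ((ℕ × ℕ) × ℕ)
  ends c0 ks = blockCtx 1 ks ++ ((0 , 0) , c0) ∷ []

  o2≤ : ∀ {o i} → 2 ≤ o → 2 ≤ o + i
  o2≤ {o} {i} o2 = ≤-trans o2 (m≤m+n o i)

  -- One arm S occupying the blocks o, …, o+m-1, preceded by the edges pre of the
  -- earlier arms and followed by the arms Ss.
  module Arm (o : ℕ) (S : List ℕ) (Ss : List (List ℕ)) (pre : List (ℕ × ℕ))
              (edges : E ≡ pre ++ (pathEdges o (length S) ++ thetaEdges (o + length S) Ss))
              (o2 : 2 ≤ o) (pre-below : ∀ b → o ≤ b → NotEnd b pre) where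
    m = length S
    PE = pathEdges o m
    TE = thetaEdges (o + m) Ss

    split : ∀ x y → edgeIn E x y ≡ edgeIn pre x y ∨ (edgeIn PE x y ∨ edgeIn TE x y)
    split x y = trans (cong (λ L → edgeIn L x y) edges) (trans (edgeIn-++ pre _ x y) (cong (edgeIn pre x y ∨_) (edgeIn-++ PE TE x y)))

    edge-next : ∀ j → o ≤ j → suc j < o + m → edgeIn E j (suc j) ≡ true
    edge-next j oj sj = edgeIn-mem E j (suc j) (subst (λ L → (j , suc j) ∈ L) (sym edges) (∈-++⁺ʳ pre (∈-++⁺ˡ mem)))
      where
      l = j ∸ o
      jl : o + l ≡ j
      jl = m+[n∸m]≡n oj
      l< : suc l < m
      l< = +-cancelˡ-< o (suc l) m (subst (_< o + m) (trans (cong suc (sym jl)) (sym (+-suc o l))) sj)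
      memPE : ∀ m → suc l < m → (o + l , o + suc l) ∈ pathEdges o m
      memPE (suc m') (s≤s l<m') = there (there (consec-mem o m' l l<m'))
      mem : (j , suc j) ∈ PE
      mem = subst (λ z → z ∈ PE) (cong₂ _,_ jl (trans (+-suc o l) (cong suc jl))) (memPE m l<)

    edge-far : ∀ j j' → o ≤ j → suc (suc j) ≤ j' → j' < o + m → edgeIn E j j' ≡ false
    edge-far j j' oj jj' j'm = trans (split j j') (∨₃-false (notEnd-l pre j j' (pre-below j oj))
       (edgeIn-none PE j j' pe) (notEnd-r TE j j' (thetaEdges-notEnd (o + m) Ss j' (o2≤ o2) j'2 j'm)))
      where
      j2 : 2 ≤ j
      j2 = ≤-trans o2 oj
      j'2 : 2 ≤ j'
      j'2 = ≤-trans j2 (≤-trans (n≤1+n j) (≤-trans (n≤1+n (suc j)) jj'))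
      pe : ∀ x y → (x , y) ∈ PE → ¬ (x ≡ j × y ≡ j') × ¬ (x ≡ j' × y ≡ j)
      pe x y mem with pathEdges-shape o m x y mem
      ... | to-first refl refl = (λ p → ge2≢0 j2 (sym (proj₁ p))) , (λ p → ge2≢0 j'2 (sym (proj₁ p)))
      ... | from-last refl _ = (λ p → ge2≢1 j'2 (sym (proj₂ p))) , (λ p → ge2≢1 j2 (sym (proj₂ p)))
      ... | inner l _ e1 e2 = (λ { (x≡j , y≡j') → 1+n≰n (≤-trans jj' (≤-reflexive (trans (sym y≡j') (trans e2 (trans (+-suc o l) (cong suc (trans (sym e1) x≡j)))))))})
                          , (λ { (x≡j' , y≡j) → 1+n≰n (≤-trans (n≤1+n _) (≤-trans (n≤1+n _) (subst (λ z → suc (suc z) ≤ j') (je x≡j' y≡j) jj'))) })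
        where je : x ≡ j' → y ≡ j → j ≡ suc j'
              je x≡j' y≡j = trans (sym y≡j) (trans e2 (trans (+-suc o l) (cong suc (trans (sym e1) x≡j'))))

    edge-later-arm : ∀ b b' → o ≤ b → b < o + m → o + m ≤ b' → edgeIn E b b' ≡ false
    edge-later-arm b b' ob bm mb' = trans (split b b') (∨₃-false (notEnd-l pre b b' (pre-below b ob))
       (notEnd-r PE b b' (pathEdges-notEnd-above o m b' o2 mb')) (notEnd-l TE b b' (thetaEdges-notEnd (o + m) Ss b (o2≤ o2) (≤-trans o2 ob) bm)))

    o≢o+1+i : ∀ i → o ≢ o + suc i
    o≢o+1+i i e = 0≢1+n (+-cancelˡ-≡ o 0 (suc i) (trans (+-identityʳ o) e))

    edge-initial : ∀ i → i < m → edgeIn E 0 (o + i) ≡ (i ≡ᵇ 0)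
    edge-initial zero i< = trans (split 0 (o + 0)) (trans (cong (λ z → edgeIn pre 0 (o + 0) ∨ (z ∨ edgeIn TE 0 (o + 0))) pe0) (∨-zeroʳ _))
      where
      mem0 : ∀ m → 0 < m → (0 , o + 0) ∈ pathEdges o m
      mem0 (suc m') _ rewrite +-identityʳ o = here refl
      pe0 : edgeIn PE 0 (o + 0) ≡ true
      pe0 = edgeIn-mem PE 0 (o + 0) (mem0 m i<)
    edge-initial (suc i) i< = trans (split 0 (o + suc i)) (∨₃-false (notEnd-r pre 0 (o + suc i) (pre-below _ (m≤m+n o _)))
        (edgeIn-none PE 0 (o + suc i) pe)
        (notEnd-r TE 0 (o + suc i) (thetaEdges-notEnd (o + m) Ss (o + suc i) (o2≤ o2) (o2≤ o2) (+-monoʳ-< o i<))))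
      where
      pe : ∀ x y → (x , y) ∈ PE → ¬ (x ≡ 0 × y ≡ o + suc i) × ¬ (x ≡ o + suc i × y ≡ 0)
      pe x y mem with pathEdges-shape o m x y mem
      ... | to-first refl refl = (λ p → o≢o+1+i i (proj₂ p)) , (λ p → ge2≢0 (o2≤ {o} {suc i} o2) (sym (proj₁ p)))
      ... | from-last refl _ = (λ p → ge2≢1 (o2≤ {o} {suc i} o2) (sym (proj₂ p))) , (λ { (_ , ()) })
      ... | inner l _ refl refl = (λ p → ge2≢0 (o2≤ {o} {l} o2) (proj₁ p)) , (λ p → ge2≢0 (o2≤ {o} {suc l} o2) (proj₂ p))

    edge-final : ∀ i → i < m → edgeIn E 1 (o + i) ≡ (suc i ≡ᵇ m)
    edge-final i i< with suc i ≡ᵇ m in e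
    ... | true = trans (split 1 (o + i)) (trans (cong (λ z → edgeIn pre 1 (o + i) ∨ (z ∨ edgeIn TE 1 (o + i))) pe1) (∨-zeroʳ _))
      where
      mem1 : ∀ m → suc i ≡ m → (o + i , 1) ∈ pathEdges o m
      mem1 (suc m') e' rewrite suc-injective e' = there (here refl)
      pe1 : edgeIn PE 1 (o + i) ≡ true
      pe1 = edgeIn-memʳ PE 1 (o + i) (mem1 m (≡ᵇ-true⇒≡ (suc i) m e))
    ... | false = trans (split 1 (o + i)) (∨₃-false (notEnd-r pre 1 (o + i) (pre-below _ (m≤m+n o _)))
        (edgeIn-none PE 1 (o + i) pe)
        (notEnd-r TE 1 (o + i) (thetaEdges-notEnd (o + m) Ss (o + i) (o2≤ o2) (o2≤ o2) (+-monoʳ-< o i<))))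
      where
      pe : ∀ x y → (x , y) ∈ PE → ¬ (x ≡ 1 × y ≡ o + i) × ¬ (x ≡ o + i × y ≡ 1)
      pe x y mem with pathEdges-shape o m x y mem
      ... | to-first refl refl = (λ { (() , _) }) , (λ p → ge2≢1 o2 (proj₂ p))
      ... | from-last refl sx = (λ p → ge2≢1 (o2≤ {o} {i} o2) (sym (proj₂ p)))
                        , (λ p → ≡ᵇ-false⇒≢ (suc i) m e (+-cancelˡ-≡ o (suc i) m (trans (+-suc o i) (trans (cong suc (sym (proj₁ p))) sx))))
      ... | inner l _ refl refl = (λ p → ge2≢1 (o2≤ {o} {l} o2) (proj₁ p)) , (λ p → ge2≢1 (o2≤ {o} {suc l} o2) (proj₂ p))

    outsideAvoid : ℕ → List ℕ → ℕ → List ℕ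
    outsideAvoid c0 ks i = (if edgeIn E 0 (o + i) then c0 ∷ [] else []) ++ (if edgeIn E 1 (o + i) then ks else [])

    ok-outside : ∀ c0 ks i p c → ok (ends c0 ks) (o + i , p) c ≡ not (elem c (outsideAvoid c0 ks i))
    ok-outside c0 ks i p c = begin
      ok (ends c0 ks) (o + i , p) c
        ≡⟨ ok-++ (blockCtx 1 ks) (((0 , 0) , c0) ∷ []) (o + i , p) c ⟩
      ok (blockCtx 1 ks) (o + i , p) c ∧ (not (adjT (0 , 0) (o + i , p) ∧ (c0 ≡ᵇ c)) ∧ true)
        ≡⟨ cong₂ (λ z w → z ∧ (not (w ∧ (c0 ≡ᵇ c)) ∧ true))
                 (ok-block 1 ks (o + i , p) c (edgeIn E 1 (o + i)) (λ p' → adjT-diff 1 (o + i) p' p (λ e → ge2≢1 (o2≤ {o} {i} o2) (sym e))))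
                 (adjT-diff 0 (o + i) 0 p (λ e → ge2≢0 (o2≤ {o} {i} o2) (sym e))) ⟩
      not (to-final ∧ elem c ks) ∧ (not (to-initial ∧ (c0 ≡ᵇ c)) ∧ true)
        ≡⟨ not-guarded-∨ to-initial to-final (c0 ≡ᵇ c) (elem c ks) ⟩
      not ((if to-initial then (c0 ≡ᵇ c) ∨ false else false) ∨ (if to-final then elem c ks else false))
        ≡⟨ cong not (sym (trans (elem-++ c (if to-initial then c0 ∷ [] else []) (if to-final then ks else []))
                                (cong₂ _∨_ (elem-if-singleton to-initial c c0) (elem-if to-final c ks)))) ⟩
      not (elem c (outsideAvoid c0 ks i)) ∎
      where
      open ≡-Reasoning
      to-initial = edgeIn E 0 (o + i)
      to-final = edgeIn E 1 (o + i)

    outsideAvoid≡endAvoid : ∀ c0 ks i → i < m → outsideAvoid c0 ks i ≡ endAvoid (c0 ∷ []) ks m i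
    outsideAvoid≡endAvoid c0 ks i i< =
      cong₂ (λ b0 b1 → (if b0 then c0 ∷ [] else []) ++ (if b1 then ks else [])) (edge-initial i i<) (edge-final i i<)

    cnt-arm : ∀ c0 ks → cnt (ends c0 ks) (chainVerts o S) ≡ pathCount (c0 ∷ []) S ks
    cnt-arm c0 ks = begin
      cnt (ends c0 ks) (chainVerts o S)
        ≡⟨ cnt-chain theta-cliqueBlocks (o + m) S o [] (outsideAvoid c0 ks) [] (ends c0 ks) ≤-refl
              (λ j oj sj p p' → trans (adjT-diff j (suc j) p p' (λ e → 1+n≢n (sym e))) (edge-next j oj sj))
              (λ j j' oj jj' j'm p p' → trans (adjT-diff j j' p p' (λ e → <⇒≱ (≤-trans (n≤1+n _) jj') (≤-reflexive (sym e)))) (edge-far j j' oj jj' j'm))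
              (λ _ p c → refl) (λ j p c _ _ → refl) (λ i p c _ → ok-outside c0 ks i p c) ⟩
      pathCountAt [] (outsideAvoid c0 ks) S
        ≡⟨ pathCountAt-cong [] [] (outsideAvoid c0 ks) (endAvoid (c0 ∷ []) ks m) S
             (λ pos x → cong (elem x) (outsideAvoid≡endAvoid c0 ks 0 pos))
             (λ i i< x → cong (elem x) (outsideAvoid≡endAvoid c0 ks (suc i) i<)) ⟩
      pathCountAt [] (endAvoid (c0 ∷ []) ks m) S
        ≡⟨ sym (pathCount≡pathCountAt (c0 ∷ []) ks S) ⟩
      pathCount (c0 ∷ []) S ks ∎
      where open ≡-Reasoning

  cnt-arms : ∀ Ss o pre c0 ks → E ≡ pre ++ thetaEdges o Ss → 2 ≤ o → (∀ b → o ≤ b → NotEnd b pre) →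
     cnt (ends c0 ks) (armsVerts o Ss) ≡ product (map (λ S → pathCount (c0 ∷ []) S ks) Ss)
  cnt-arms [] o pre c0 ks edges o2 pre-below = refl
  cnt-arms (S ∷ Ss) o pre c0 ks edges o2 pre-below = begin
    cnt (ends c0 ks) (chainVerts o S ++ armsVerts (o + m) Ss)
      ≡⟨ cnt-independent (ends c0 ks) (chainVerts o S) (armsVerts (o + m) Ss) no-edges-to-later-arms ⟩
    cnt (ends c0 ks) (chainVerts o S) * cnt (ends c0 ks) (armsVerts (o + m) Ss)
      ≡⟨ cong₂ _*_ (cnt-arm c0 ks) (cnt-arms Ss (o + m) (pre ++ PE) c0 ks edges' (o2≤ o2) pre-below') ⟩
    pathCount (c0 ∷ []) S ks * product (map (λ S → pathCount (c0 ∷ []) S ks) Ss) ∎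
    where
    open ≡-Reasoning
    open Arm o S Ss pre edges o2 pre-below
    edges' : E ≡ (pre ++ PE) ++ thetaEdges (o + m) Ss
    edges' = trans edges (sym (++-assoc pre PE _))
    pre-below' : ∀ b → o + m ≤ b → NotEnd b (pre ++ PE)
    pre-below' b ob = NotEnd-++ b pre PE (pre-below b (≤-trans (m≤m+n o m) ob)) (pathEdges-notEnd-above o m b o2 ob)
    no-edges-to-later-arms : ∀ u → u ∈ chainVerts o S → ∀ v → v ∈ armsVerts (o + m) Ss → adjT u v ≡ false
    no-edges-to-later-arms (b , p) u∈ (b' , p') v∈ with chainVerts-range o S b p u∈ | armsVerts-range (o + m) Ss b' p' v∈
    ... | lo , hi | mb' = trans (adjT-diff b b' p p' (λ e → <⇒≱ hi (subst (o + m ≤_) (sym e) mb'))) (edge-later-arm b b' lo hi mb')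

applyUpTo-++ : ∀ {A : Set} (f : ℕ → A) m n → applyUpTo f (m + n) ≡ applyUpTo f m ++ applyUpTo (λ i → f (m + i)) n
applyUpTo-++ f zero n = refl
applyUpTo-++ f (suc m) n = cong (f 0 ∷_) (applyUpTo-++ (λ i → f (suc i)) m n)

size-++ˡ : ∀ A B i → i < length A → size (A ++ B) i ≡ size A i
size-++ˡ (a ∷ A) B zero _ = refl
size-++ˡ (a ∷ A) B (suc i) (s≤s i<) = size-++ˡ A B i i<

size-++ʳ : ∀ A B j → size (A ++ B) (length A + j) ≡ size B j
size-++ʳ [] B j = refl
size-++ʳ (a ∷ A) B j = size-++ʳ A B j

module VertexOrder (Z : List ℕ) where
  blockVerts : ℕ → List (ℕ × ℕ)
  blockVerts b = map (λ p → (b , p)) (upTo (size Z b))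

  chain-vertices : ∀ S β (f : ℕ → ℕ) → (∀ i → f i ≡ β + i) → (∀ i → i < length S → size Z (β + i) ≡ size S i) →
       concatMap blockVerts (applyUpTo f (length S)) ≡ chainVerts β S
  chain-vertices [] β f hf hs = refl
  chain-vertices (s ∷ S) β f hf hs = cong₂ _++_ first-block (chain-vertices S (suc β) (λ i → f (suc i)) (λ i → trans (hf (suc i)) (+-suc β i))
       (λ i i< → trans (cong (size Z) (sym (+-suc β i))) (hs (suc i) (s≤s i<))))
    where
    first-index : f 0 ≡ β
    first-index = trans (hf 0) (+-identityʳ β)
    first-block : blockVerts (f 0) ≡ map (λ p → (β , p)) (upTo s)
    first-block rewrite first-index = cong (λ z → map (λ p → (β , p)) (upTo z)) (trans (cong (size Z) (sym (+-identityʳ β))) (hs 0 (s≤s z≤n)))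

  arms-vertices : ∀ Ss o (f : ℕ → ℕ) → (∀ i → f i ≡ o + i) → (∀ j → size Z (o + j) ≡ size (concat Ss) j) →
       concatMap blockVerts (applyUpTo f (length (concat Ss))) ≡ armsVerts o Ss
  arms-vertices [] o f hf hs = refl
  arms-vertices (S ∷ Ss) o f hf hs = begin
    concatMap blockVerts (applyUpTo f (length (S ++ concat Ss)))
      ≡⟨ cong (λ n → concatMap blockVerts (applyUpTo f n)) (length-++ S) ⟩
    concatMap blockVerts (applyUpTo f (length S + length (concat Ss)))
      ≡⟨ cong (concatMap blockVerts) (applyUpTo-++ f (length S) _) ⟩
    concatMap blockVerts (applyUpTo f (length S) ++ applyUpTo (λ i → f (length S + i)) (length (concat Ss)))
      ≡⟨ concatMap-++ blockVerts (applyUpTo f (length S)) _ ⟩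
    concatMap blockVerts (applyUpTo f (length S)) ++ concatMap blockVerts (applyUpTo (λ i → f (length S + i)) (length (concat Ss)))
      ≡⟨ cong₂ _++_ (chain-vertices S o f hf (λ i i< → trans (hs i) (size-++ˡ S (concat Ss) i i<)))
                    (arms-vertices Ss (o + length S) (λ i → f (length S + i)) (λ i → trans (hf _) (sym (+-assoc o (length S) i)))
                        (λ j → trans (cong (size Z) (+-assoc o (length S) j)) (trans (hs (length S + j)) (size-++ʳ S (concat Ss) j)))) ⟩
    armsVerts o (S ∷ Ss) ∎
    where open ≡-Reasoning

module ThetaPoly (q : ℕ) (Ss₀ : List (List ℕ)) (k : ℕ) where
  open ThetaColourings q Ss₀ k
  open Cnt q adjT
  open CntProperties q adjT
  open Blocks q adjT
  open Tuples q
  open PathCount q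
  open VertexOrder (1 ∷ k ∷ concat Ss₀)

  theta-vertices : verts (cliqueTheta Ss₀ k) ≡ (0 , 0) ∷ (map (λ p → (1 , p)) (upTo k) ++ armsVerts 2 Ss₀)
  theta-vertices = cong (λ z → (0 , 0) ∷ (map (λ p → (1 , p)) (upTo k) ++ z)) (arms-vertices Ss₀ 2 (λ i → suc (suc i)) (λ i → refl) (λ j → refl))

  chromPoly-theta : chromPoly (cliqueTheta Ss₀ k) q ≡ sumTo q (λ c0 → tuples [] k [] (λ ks → product (map (λ S → pathCount (c0 ∷ []) S ks) Ss₀)))
  chromPoly-theta = begin
    chromPoly (cliqueTheta Ss₀ k) q
      ≡⟨ chromPoly≡cnt (cliqueTheta Ss₀ k) q ⟩
    cnt [] (verts (cliqueTheta Ss₀ k))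
      ≡⟨ cong (cnt []) theta-vertices ⟩
    sumTo q (λ c0 → cnt (((0 , 0) , c0) ∷ []) (map (λ p → (1 , p)) (upTo k) ++ armsVerts 2 Ss₀))
      ≡⟨ sumTo-cong q (λ c0 _ → given-initial c0) ⟩
    sumTo q (λ c0 → tuples [] k [] (λ ks → product (map (λ S → pathCount (c0 ∷ []) S ks) Ss₀))) ∎
    where
    open ≡-Reasoning
    given-initial : ∀ c0 → cnt (((0 , 0) , c0) ∷ []) (map (λ p → (1 , p)) (upTo k) ++ armsVerts 2 Ss₀) ≡ tuples [] k [] (λ ks → product (map (λ S → pathCount (c0 ∷ []) S ks) Ss₀))
    given-initial c0 = begin
      cnt Δ (map (λ p → (1 , p)) (upTo k) ++ armsVerts 2 Ss₀)
        ≡⟨ cntK-++ Δ (map (λ p → (1 , p)) (upTo k)) (armsVerts 2 Ss₀) (λ _ → 1) ⟩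
      cntK Δ (map (λ p → (1 , p)) (upTo k)) (λ Γ → cnt Γ (armsVerts 2 Ss₀))
        ≡⟨ cnt-clique theta-cliqueBlocks 1 [] Δ (λ Γ → cnt Γ (armsVerts 2 Ss₀)) final-unconstrained k [] (λ i → i) (λ i → refl) ⟩
      tuples [] k [] (λ ks → cnt (blockCtx 1 ks ++ Δ) (armsVerts 2 Ss₀))
        ≡⟨ tuples-cong [] k [] (λ ks → cnt-arms Ss₀ 2 [] c0 ks refl ≤-refl (λ b _ x y ())) ⟩
      tuples [] k [] (λ ks → product (map (λ S → pathCount (c0 ∷ []) S ks) Ss₀)) ∎
      where
      Δ = ((0 , 0) , c0) ∷ []
      final-unconstrained : ∀ p c → ok Δ (1 , p) c ≡ not (elem c [])
      final-unconstrained p c rewrite thetaEdges-01 2 Ss₀ ≤-refl = refl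

module PathPoly (q : ℕ) (Z : List ℕ) where
  EL : List (ℕ × ℕ)
  EL = map (λ i → (i , suc i)) (upTo (length Z ∸ 1))
  adjL : ℕ × ℕ → ℕ × ℕ → Bool
  adjL = Graph.adj (cliquePath Z)

  open Cnt q adjL
  open Blocks q adjL
  open ChainColourings q adjL
  open PathCount q
  open PathCountAt q
  open VertexOrder Z

  n = length Z ∸ 1

  adjL-diff : ∀ b b' p p' → b ≢ b' → adjL (b , p) (b' , p') ≡ edgeIn EL b b'
  adjL-diff b b' p p' ne rewrite ≢⇒≡ᵇ-false b b' ne = refl

  noloop : ∀ b → edgeIn EL b b ≡ false
  noloop b = edgeIn-none EL b b (λ x y mem → f x y mem , f x y mem)
    where f : ∀ x y → (x , y) ∈ EL → ¬ (x ≡ b × y ≡ b)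
          f x y mem (e1 , e2) with consec-shape 0 n x y mem
          ... | l , _ , refl , refl = 1+n≢n (trans e2 (sym e1))

  path-cliqueBlocks : CliqueBlocks
  path-cliqueBlocks b p p' rewrite ≡ᵇ-refl b | noloop b = ∨-identityʳ _

  path-joined : ∀ j → 0 ≤ j → suc j < length Z → ∀ p p' → adjL (j , p) (suc j , p') ≡ true
  path-joined j _ sj p p' = trans (adjL-diff j (suc j) p p' (λ e → 1+n≢n (sym e))) (edgeIn-mem EL j (suc j) (consec-mem 0 n j jn))
    where jn : j < n
          jn = ∸-monoˡ-≤ 1 sj

  path-apart : ∀ j j' → 0 ≤ j → suc (suc j) ≤ j' → j' < length Z → ∀ p p' → adjL (j , p) (j' , p') ≡ false
  path-apart j j' _ jj' _ p p' = trans (adjL-diff j j' p p' (λ e → <⇒≱ (≤-trans (n≤1+n _) jj') (≤-reflexive (sym e))))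
     (edgeIn-none EL j j' (λ x y mem → f x y mem))
    where
    f : ∀ x y → (x , y) ∈ EL → ¬ (x ≡ j × y ≡ j') × ¬ (x ≡ j' × y ≡ j)
    f x y mem with consec-shape 0 n x y mem
    ... | l , _ , refl , refl = (λ { (refl , refl) → 1+n≰n jj' })
                              , (λ { (refl , refl) → 1+n≰n (≤-trans (n≤1+n _) (≤-trans (n≤1+n _) jj')) })

  elem-endAvoid-[] : ∀ m i x → elem x (endAvoid [] [] m i) ≡ false
  elem-endAvoid-[] m i x with i ≡ᵇ 0 | suc i ≡ᵇ m
  ... | true | true = refl
  ... | true | false = refl
  ... | false | true = refl
  ... | false | false = refl

  chromPoly-path : chromPoly (cliquePath Z) q ≡ pathCount [] Z []
  chromPoly-path = begin
    chromPoly (cliquePath Z) q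
      ≡⟨ chromPoly≡cnt (cliquePath Z) q ⟩
    cnt [] (concatMap blockVerts (upTo (length Z)))
      ≡⟨ cong (cnt []) (chain-vertices Z 0 (λ i → i) (λ i → refl) (λ i _ → refl)) ⟩
    cnt [] (chainVerts 0 Z)
      ≡⟨ cnt-chain path-cliqueBlocks (length Z) Z 0 [] (λ _ → []) [] [] ≤-refl path-joined path-apart (λ _ p c → refl) (λ _ _ _ _ _ → refl) (λ i p c _ → refl) ⟩
    pathCountAt [] (λ _ → []) Z
      ≡⟨ pathCountAt-cong [] [] (λ _ → []) (endAvoid [] [] (length Z)) Z (λ _ x → sym (elem-endAvoid-[] (length Z) 0 x)) (λ i _ x → sym (elem-endAvoid-[] (length Z) (suc i) x)) ⟩
    pathCountAt [] (endAvoid [] [] (length Z)) Z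
      ≡⟨ sym (pathCount≡pathCountAt [] [] Z) ⟩
    pathCount [] Z [] ∎
    where open ≡-Reasoning

module Identity (q : ℕ) (k : ℕ) where
  open Tuples q
  open PathCount q
  open Recurrence q

  -- Σ over the colour c0 of the initial vertex and the colours ks of the final
  -- k-clique
  sumTuples : (ℕ → List ℕ → ℕ) → ℕ
  sumTuples g = sumTo q (λ c0 → tuples [] k [] (g c0))

  sumTuples-ext : ∀ {g h} → (∀ c0 ks → c0 < q → Distinct ks → All (_< q) ks → length ks ≡ k → g c0 ks ≡ h c0 ks) →
    sumTuples g ≡ sumTuples h
  sumTuples-ext gh = sumTo-cong q (λ c0 c0<q → tuples-ext [] k [] (λ ks g →
    gh c0 ks c0<q (grows-distinct g tt) (grows-bounded g []) (trans (grows-length g) (+-identityʳ k))))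

  sumTuples-*ʳ : ∀ g m → sumTuples g * m ≡ sumTuples (λ c0 ks → g c0 ks * m)
  sumTuples-*ʳ g m = trans (sym (sumTo-*ʳ q _ m)) (sumTo-cong q (λ c0 _ → sym (tuples-*ʳ [] k [] (g c0) m)))

  sumTuples-combine : ∀ g h m n → sumTuples g * m + sumTuples h * n ≡ sumTuples (λ c0 ks → g c0 ks * m + h c0 ks * n)
  sumTuples-combine g h m n =
    trans (cong₂ _+_ (sumTuples-*ʳ g m) (sumTuples-*ʳ h n))
          (trans (sym (sumTo-+ q _ _)) (sumTo-cong q (λ c0 _ → sym (tuples-+ [] k [] _ _))))

  -- The identity in ℕ: multiply the arm recurrence by the contribution Q of
  -- the remaining arms and sum over the colourings of the two ends.
  identityℕ : ∀ a b rest Ss →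
    chromPoly (cliqueTheta ((a ∷ b ∷ rest) ∷ Ss) k) q * ff q k * ff q (suc b)
      + a * ff q (a + b) * chromPoly (cliqueTheta ((b ∷ rest) ∷ Ss) k) q * ff q k
    ≡ chromPoly (cliqueTheta Ss k) q * chromPoly (cliquePath (a ∷ b ∷ rest ++ k ∷ [])) q * ff q (suc b)
  identityℕ a b rest Ss = begin
    PT * FK * B1 + aA * PTb * FK
      ≡⟨ solve 5 (λ PT FK B1 aA PTb → PT :* FK :* B1 :+ aA :* PTb :* FK := PT :* (FK :* B1) :+ PTb :* (aA :* FK)) refl PT FK B1 aA PTb ⟩
    PT * (FK * B1) + PTb * (aA * FK)
      ≡⟨ cong₂ (λ z w → z * (FK * B1) + w * (aA * FK)) (ThetaPoly.chromPoly-theta q ((a ∷ b ∷ rest) ∷ Ss) k)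
                                                      (ThetaPoly.chromPoly-theta q ((b ∷ rest) ∷ Ss) k) ⟩
    sumTuples (λ c0 ks → X c0 ks * Q c0 ks) * (FK * B1) + sumTuples (λ c0 ks → Xb c0 ks * Q c0 ks) * (aA * FK)
      ≡⟨ sumTuples-combine _ _ _ _ ⟩
    sumTuples (λ c0 ks → X c0 ks * Q c0 ks * (FK * B1) + Xb c0 ks * Q c0 ks * (aA * FK))
      ≡⟨ sumTuples-ext arm-recurrence ⟩
    sumTuples (λ c0 ks → Q c0 ks * (PL * B1))
      ≡⟨ sym (sumTuples-*ʳ Q (PL * B1)) ⟩
    sumTuples Q * (PL * B1)
      ≡⟨ cong₂ (λ z w → z * (w * B1)) (sym (ThetaPoly.chromPoly-theta q Ss k)) (sym (PathPoly.chromPoly-path q (a ∷ b ∷ rest ++ k ∷ []))) ⟩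
    PT' * (chromPoly (cliquePath (a ∷ b ∷ rest ++ k ∷ [])) q * B1)
      ≡⟨ sym (*-assoc PT' _ B1) ⟩
    PT' * chromPoly (cliquePath (a ∷ b ∷ rest ++ k ∷ [])) q * B1 ∎
    where
    open ≡-Reasoning
    open +-*-Solver
    PT = chromPoly (cliqueTheta ((a ∷ b ∷ rest) ∷ Ss) k) q
    PTb = chromPoly (cliqueTheta ((b ∷ rest) ∷ Ss) k) q
    PT' = chromPoly (cliqueTheta Ss k) q
    FK = ff q k
    B1 = ff q (suc b)
    aA = a * ff q (a + b)
    PL = pathCount [] (a ∷ b ∷ rest ++ k ∷ []) []
    X = λ c0 ks → pathCount (c0 ∷ []) (a ∷ b ∷ rest) ks
    Xb = λ c0 ks → pathCount (c0 ∷ []) (b ∷ rest) ks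
    Q = λ c0 ks → product (map (λ S → pathCount (c0 ∷ []) S ks) Ss)
    arm-recurrence : ∀ c0 ks → c0 < q → Distinct ks → All (_< q) ks → length ks ≡ k →
      X c0 ks * Q c0 ks * (FK * B1) + Xb c0 ks * Q c0 ks * (aA * FK) ≡ Q c0 ks * (PL * B1)
    arm-recurrence c0 ks c0<q d al lk = begin
      X c0 ks * Q c0 ks * (FK * B1) + Xb c0 ks * Q c0 ks * (aA * FK)
        ≡⟨ solve 6 (λ x qq fk b1 aa xb → x :* qq :* (fk :* b1) :+ xb :* qq :* (aa :* fk) := qq :* (x :* fk :* b1 :+ aa :* xb :* fk)) refl
             (X c0 ks) (Q c0 ks) FK B1 aA (Xb c0 ks) ⟩
      Q c0 ks * (X c0 ks * FK * B1 + aA * Xb c0 ks * FK)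
        ≡⟨ cong (Q c0 ks *_) (pathCount-recurrence c0 a b rest k ks c0<q d al lk) ⟩
      Q c0 ks * (PL * B1) ∎

-- Passing to ℤ (imported only here: its +_ would clash with sections of ℕ's _+_).

open import Data.Integer using (ℤ; +_; _-_) renaming (_*_ to _*ℤ_)
import Data.Integer.Properties as ℤP

sub-from-sum : ∀ {x m y} → x + m ≡ y → + x ≡ + y - + m
sub-from-sum {x} {m} refl = sym (trans (ℤP.m-n≡m⊖n (x + m) m) (trans (ℤP.⊖-≥ (m≤n+m m x)) (cong +_ (m+n∸n≡m x m))))

pos-*₃ : ∀ x y z → + (x * y * z) ≡ + x *ℤ + y *ℤ + z
pos-*₃ x y z = trans (ℤP.pos-* (x * y) z) (cong (_*ℤ + z) (ℤP.pos-* x y))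

pos-*₄ : ∀ w x y z → + (w * x * y * z) ≡ + w *ℤ + x *ℤ + y *ℤ + z
pos-*₄ w x y z = trans (ℤP.pos-* (w * x * y) z) (cong (_*ℤ + z) (pos-*₃ w x y))

lemma5 : (k a b : ℕ) → (rest : List ℕ) → (Ss : List (List ℕ)) →
    1 ≤ k → 1 ≤ length Ss → 1 ≤ a → 1 ≤ b → All (λ x → 1 ≤ x) rest →
    All (λ S → S ≢ []) Ss → All (All (λ x → 1 ≤ x)) Ss →
    (q : ℕ) →
    + chromPoly (cliqueTheta ((a ∷ b ∷ rest) ∷ Ss) k) q *ℤ + ff q k *ℤ + ff q (suc b)
    ≡ + chromPoly (cliqueTheta Ss k) q *ℤ + chromPoly (cliquePath (a ∷ b ∷ rest ++ k ∷ [])) q *ℤ + ff q (suc b)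
    - + a *ℤ + ff q (a + b) *ℤ + chromPoly (cliqueTheta ((b ∷ rest) ∷ Ss) k) q *ℤ + ff q k
lemma5 k a b rest Ss _ _ _ _ _ _ _ q = begin
    + PT *ℤ + ff q k *ℤ + ff q (suc b)
      ≡⟨ sym (pos-*₃ PT (ff q k) (ff q (suc b))) ⟩
    + (PT * ff q k * ff q (suc b))
      ≡⟨ sub-from-sum (Identity.identityℕ q k a b rest Ss) ⟩
    + (PT' * PL * ff q (suc b)) - + (a * ff q (a + b) * PTb * ff q k)
      ≡⟨ cong₂ _-_ (pos-*₃ PT' PL (ff q (suc b))) (pos-*₄ a (ff q (a + b)) PTb (ff q k)) ⟩
    + PT' *ℤ + PL *ℤ + ff q (suc b) - + a *ℤ + ff q (a + b) *ℤ + PTb *ℤ + ff q k ∎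
  where
  open ≡-Reasoning
  PT = chromPoly (cliqueTheta ((a ∷ b ∷ rest) ∷ Ss) k) q
  PTb = chromPoly (cliqueTheta ((b ∷ rest) ∷ Ss) k) q
  PT' = chromPoly (cliqueTheta Ss k) q
  PL = chromPoly (cliquePath (a ∷ b ∷ rest ++ k ∷ [])) q
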